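{- Let $\mathbb{k}$ be a commutative ring, $n\ge0$, $F\in\Sigma_n$ and $\alpha$ a composition of $n$. Then there exist scalars $c_G\in\mathbb{k}$ such that \[ F\,\widetilde{w}_0\,\widetilde{B}_\alpha=\widetilde{n}_\alpha(F)\,F+\sum_{G\in\Sigma_n:\ \ell(G)>\ell(F)}c_GG\quad\text{in }\mathbb{k}\Sigma_n. \]
   Context: $[n]=\{1,\ldots,n\}$; $S_n$ the symmetric group, $\mathbb{k}S_n$ its group algebra, $w_0(i)=n+1-i$. For a composition $\beta=(\beta_1,\ldots,\beta_k)$ of $n$ (positive integers with sum $n$) let $D(\beta)=\{\beta_1,\ldots,\beta_1+\cdots+\beta_{k-1}\}$ and $B_\beta=\sum_{w\in S_n:\operatorname{Des}w\subseteq D(\beta)}w$, where $\operatorname{Des}w=\{i\in[n-1]:w(i)>w(i+1)\}$; the $B_\beta$ are linearly independent, their span is the descent algebra $\mathcal{D}(S_n)$, and $w_0\in\mathcal{D}(S_n)$. A face of $[n]$ is a tuple $F=(F_1,\ldots,F_k)$ of nonempty pairwise disjoint sets with union $[n]$; $\ell(F)=k$; $\operatorname{type}F=(|F_1|,\ldots,|F_k|)$; $\Sigma_n$ is the set of faces. The product of $F=(F_1,\ldots,F_k)$ and $G=(G_1,\ldots,G_m)$ is the list of the $F_i\cap G_j$ in lexicographic order of $(i,j)$ with empty sets deleted; $\mathbb{k}\Sigma_n$ is the monoid algebra. $\widetilde{B}_\beta=\sum_{F:\operatorname{type}F=\beta}F$. $\rho:\mathcal{D}(S_n)\to\mathbb{k}\Sigma_n$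 is the $\mathbb{k}$-linear map with $\rho(B_\beta)=\widetilde{B}_\beta$, and $\widetilde{w}_0:=\rho(w_0)$. $F\preceq G$ means each block of $F$ lies in some block of $G$; $n_\alpha(F)=\#\{G:F\preceq G,\operatorname{type}G=\alpha\}$; $\widetilde{n}_\alpha(F)=(-1)^{n-\ell(F)}n_\alpha(F)$. -}

module Defs where

open import Data.Bool using (Bool; true; false; if_then_else_; _∧_; _∨_; T; not)
open import Data.Nat using (ℕ; zero; suc; _∸_; _⊔_; _<ᵇ_; _≡ᵇ_; _≤_)
import Data.Nat
open import Data.List using (List; []; _∷_; map; filter; concatMap; _++_; length; foldr; upTo; reverse; allFin)
open import Data.Nat.ListAction using (sum)
open import Data.List.Relation.Unary.All using (All)
open import Relation.Nullary.Decidable using (T?)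
open import Data.Vec using (Vec; toList; tabulate; lookup; zipWith)
import Data.Vec as Vec
open import Data.Fin using (Fin; toℕ)
open import Data.Fin.Permutation using (Permutation′; _⟨$⟩ʳ_)
open import Data.Product using (_×_; _,_)
open import Relation.Nullary.Decidable using (⌊_⌋; does)
open import Relation.Binary.PropositionalEquality using (_≡_)
import Data.List.Properties as LP
import Data.Vec.Properties as VP
import Data.Nat.Properties as NP
open import Algebra.Bundles using (CommutativeRing)

elemᵇ : ℕ → List ℕ → Bool
elemᵇ j xs = foldr (λ y b → (j ≡ᵇ y) ∨ b) false xs

allᵇ : {A : Set} → (A → Bool) → List A → Bool
allᵇ p = foldr (λ x b → p x ∧ b) true

countᵇ : ℕ → List ℕ → ℕ
countᵇ j xs = length (filter (λ y → j Data.Nat.≟ y) xs)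

-- A face F = (F_1,…,F_k) of [n] is encoded as the vector v : Vec ℕ n with
-- v[x] = i - 1 whenever the element x+1 of [n] lies in the block F_i
-- (element x : Fin n stands for x+1 ∈ [n]; blocks are 0-indexed).

-- number of blocks ℓ(F) = (max entry) + 1  (0 for the empty face, n = 0)
len : ∀ {n} → Vec ℕ n → ℕ
len v = foldr (λ x m → suc x ⊔ m) 0 (toList v)

isFace : ∀ {n} → Vec ℕ n → Bool
isFace v = allᵇ (λ j → elemᵇ j (toList v)) (upTo (len v))

vecs : (m b : ℕ) → List (Vec ℕ m)
vecs zero    b = Vec.[] ∷ []
vecs (suc m) b = concatMap (λ j → map (j Vec.∷_) (vecs m b)) (upTo b)

faces : (n : ℕ) → List (Vec ℕ n)
faces n = filter (λ v → T? (isFace v)) (vecs n n)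

type : ∀ {n} → Vec ℕ n → List ℕ
type v = map (λ i → countᵇ i (toList v)) (upTo (len v))

-- product of faces: blocks F_i ∩ G_j (nonempty ones) in lexicographic
-- order of (i,j).  The pair (i,j) is encoded by the key i*n + j
-- (j < n), which is lexicographic; the new block index of x is the number
-- of occurring keys smaller than the key of x.
_·ᶠ_ : ∀ {n} → Vec ℕ n → Vec ℕ n → Vec ℕ n
_·ᶠ_ {n} F G = Vec.map rank keys
  where
  keys : Vec ℕ n
  keys = zipWith (λ a b → a Data.Nat.* n Data.Nat.+ b) F G
  rank : ℕ → ℕ
  rank k = length (filter (λ j → T? (elemᵇ j (toList keys))) (upTo k))

_⪯ᵇ_ : ∀ {n} → Vec ℕ n → Vec ℕ n → Bool
_⪯ᵇ_ {n} F G =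
  allᵇ (λ x → allᵇ (λ y → not (lookup F x ≡ᵇ lookup F y) ∨ (lookup G x ≡ᵇ lookup G y))
                 (allFin n))
      (allFin n)

IsComposition : ℕ → List ℕ → Set
IsComposition n α = All (λ a → 1 ≤ a) α × sum α ≡ n

incHead : List ℕ → List (List ℕ)
incHead []      = []
incHead (a ∷ r) = (suc a ∷ r) ∷ []

comps : ℕ → List (List ℕ)
comps zero    = [] ∷ []
comps (suc n) = map (1 ∷_) (comps n) ++ concatMap incHead (comps n)

partialSums : ℕ → List ℕ → List ℕ
partialSums s []          = []
partialSums s (a ∷ [])    = []
partialSums s (a ∷ b ∷ r) = (s Data.Nat.+ a) ∷ partialSums (s Data.Nat.+ a) (b ∷ r)

D : List ℕ → List ℕ
D β = partialSums 0 β

-- Permutations and descents.  w : Permutation′ n acts on Fin n; the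
-- one-line notation (w(1),…,w(n)) (shifted by -1) is the list below.

oneLine : ∀ {n} → Permutation′ n → List ℕ
oneLine {n} w = toList (tabulate {n = n} (λ i → toℕ (w ⟨$⟩ʳ i)))

desFrom : ℕ → List ℕ → List ℕ
desFrom k []          = []
desFrom k (a ∷ [])    = []
desFrom k (a ∷ b ∷ r) = (if b <ᵇ a then k ∷ [] else []) ++ desFrom (suc k) (b ∷ r)

Des : ∀ {n} → Permutation′ n → List ℕ
Des w = desFrom 1 (oneLine w)

desSubᵇ : ∀ {n} → Permutation′ n → List ℕ → Bool
desSubᵇ w β = allᵇ (λ i → elemᵇ i (D β)) (Des w)

isW₀ᵇ : ∀ {n} → Permutation′ n → Bool
isW₀ᵇ {n} w = ⌊ LP.≡-dec Data.Nat._≟_ (oneLine w) (reverse (upTo n)) ⌋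

module _ {c ℓ} (R : CommutativeRing c ℓ) where
  open CommutativeRing R using (Carrier; _≈_; _+_; _*_; -_; 0#; 1#)

  Σsum : List Carrier → Carrier
  Σsum = foldr _+_ 0#

  fromℕ : ℕ → Carrier
  fromℕ zero    = 0#
  fromℕ (suc m) = 1# + fromℕ m

  sgn : ℕ → Carrier
  sgn zero    = 1#
  sgn (suc m) = - (sgn m)

  -- The group algebra 𝕜S_n: an element is given by its coefficient
  -- function S_n → 𝕜.  The element Σ_β c_β B_β has coefficient at w
  -- equal to Σ_{β : Des w ⊆ D(β)} c_β; w₀ has coefficient δ_{w,w₀}.

  -- (c_β)_β are the coordinates of w₀ in the basis (B_β) of 𝒟(S_n):
  -- Σ_β c_β B_β = w₀ in 𝕜S_n.
  W₀Coords : (n : ℕ) → (List ℕ → Carrier) → Set ℓ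
  W₀Coords n cβ = (w : Permutation′ n) →
    Σsum (map (λ β → if desSubᵇ w β then cβ β else 0#) (comps n))
      ≈ (if isW₀ᵇ w then 1# else 0#)

  -- The monoid algebra 𝕜Σ_n: elements are finite formal sums
  -- Σ a_F F, represented as lists of (coefficient, face); two elements
  -- are equal iff all their coefficients agree (see _≋_).

  Alg : ℕ → Set c
  Alg n = List (Carrier × Vec ℕ n)

  coeff : ∀ {n} → Alg n → Vec ℕ n → Carrier
  coeff x H = Σsum (map (λ { (a , G) → if ⌊ VP.≡-dec Data.Nat._≟_ G H ⌋ then a else 0# }) x)

  _≋_ : ∀ {n} → Alg n → Alg n → Set ℓ
  _≋_ {n} x y = (H : Vec ℕ n) → coeff x H ≈ coeff y H

  basis : ∀ {n} → Vec ℕ n → Alg n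
  basis F = (1# , F) ∷ []

  _⊕_ : ∀ {n} → Alg n → Alg n → Alg n
  x ⊕ y = x ++ y

  _⊙_ : ∀ {n} → Carrier → Alg n → Alg n
  a ⊙ x = map (λ { (b , G) → (a * b , G) }) x

  _⊛_ : ∀ {n} → Alg n → Alg n → Alg n
  x ⊛ y = concatMap (λ { (a , F) → map (λ { (b , G) → (a * b , F ·ᶠ G) }) y }) x

  sumOver : ∀ {n} → (Vec ℕ n → Bool) → (Vec ℕ n → Carrier) → Alg n
  sumOver {n} P d = map (λ G → (d G , G)) (filter (λ G → T? (P G)) (faces n))

  B̃ : (n : ℕ) → List ℕ → Alg n
  B̃ n β = sumOver (λ F → ⌊ LP.≡-dec Data.Nat._≟_ (type F) β ⌋) (λ _ → 1#)

  -- ρ(Σ_β c_β B_β) = Σ_β c_β B̃_β ;  with c the coordinates of w₀ this is w̃₀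
  ρ : (n : ℕ) → (List ℕ → Carrier) → Alg n
  ρ n cβ = concatMap (λ β → cβ β ⊙ B̃ n β) (comps n)

  nα : ∀ {n} → List ℕ → Vec ℕ n → ℕ
  nα {n} α F = length (filter (λ G → T? ((F ⪯ᵇ G) ∧ ⌊ LP.≡-dec Data.Nat._≟_ (type G) α ⌋)) (faces n))

  ñα : ∀ {n} → List ℕ → Vec ℕ n → Carrier
  ñα {n} α F = sgn (n ∸ len F) * fromℕ (nα α F)

{-# OPTIONS --safe #-}
module Submission where

-- Multiplying by F only refines it: a face (F·G)·K is either F itself, exactly when
-- F ⪯ G and F ⪯ K, or a face with more blocks than F.  So only the coefficient of F
-- has to be computed.
-- Testing the defining identity of the coordinates c_β of w₀ on permutations with a
-- prescribed descent set U gives Σ_{D(β) ⊇ U} c_β = [U = [n-1]], whose only solution is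
-- c_β = (-1)^(n-ℓ(β)).  Hence w̃₀ = Σ_G (-1)^(n-ℓ(G)) G, and the coefficient of F is
-- n_α(F) · Σ_{G ⪰ F} (-1)^(n-ℓ(G)).
-- The faces G ⪰ F are the faces of the set of the ℓ(F) blocks of F, and
-- Σ_{H ∈ Σ_k} (-1)^(k-ℓ(H)) = 1: a face H′ of the last k-1 elements arises from ℓ(H′)
-- faces in which the first element joins a block and from ℓ(H′)+1 faces in which it is
-- a singleton block, and these contributions cancel down to (-1)^(k-1-ℓ(H′)).

open import Defs
open import Algebra.Bundles using (CommutativeRing)
import Algebra.Properties.CommutativeSemigroup as CommutativeSemigroupProperties
import Algebra.Properties.Ring as RingProperties
open import Data.Bool using (Bool; true; false; T; not; _∧_; _∨_; if_then_else_)
import Data.Bool.Properties as Boolₚ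
open import Data.Bool.Properties using (T-∧; T-∨; T-≡; T-not-≡)
open import Data.Empty using (⊥-elim)
open import Data.Fin using (Fin; toℕ)
import Data.Fin as Fin
import Data.Fin.Properties as Finₚ
open import Data.Fin.Permutation using (Permutation′; _⟨$⟩ʳ_; insert)
import Data.Fin.Permutation as Perm
open import Data.List using (List; []; _∷_; _++_; map; filter; concatMap; length; upTo; downFrom; allFin)
import Data.List.Properties as Listₚ
open import Data.List.Membership.Propositional using (_∈_; find)
open import Data.List.Membership.Propositional.Properties using (∈-upTo⁺; ∈-upTo⁻; ∈-allFin; ∈-map⁻; ∈-concatMap⁻; ∈-filter⁻)
open import Data.List.Relation.Unary.All using (All; []; _∷_)
import Data.List.Relation.Unary.All.Properties as Allₚ
open import Data.List.Relation.Unary.Any using (here; there)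
open import Data.Nat using (ℕ; zero; suc; _∸_; _≤_; _<_; z≤n; s≤s; _<ᵇ_; _≡ᵇ_)
import Data.Nat as ℕ
import Data.Nat.Properties as ℕₚ
open import Data.Nat.ListAction using (sum)
import Data.Nat.ListAction.Properties as Sumₚ
open import Data.Product using (∃; ∃-syntax; _×_; _,_; proj₁; proj₂)
open import Data.Sum using (inj₁; inj₂)
open import Data.Unit using (tt)
open import Data.Vec using (Vec; lookup; toList; tabulate)
import Data.Vec as Vec
import Data.Vec.Properties as Vecₚ
import Data.Vec.Relation.Unary.All as AllV
import Data.Vec.Relation.Unary.All.Properties as AllVₚ
open import Data.Vec.Relation.Binary.Pointwise.Extensional using (ext; Pointwise-≡⇒≡)
open import Function using (_∘_; id)
open import Function.Bundles using (Equivalence)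
open import Level using (Level)
open import Relation.Binary using (tri<; tri≈; tri>)
import Relation.Binary.PropositionalEquality as ≡
open ≡ using (_≡_; _≢_)
open import Relation.Nullary using (¬_; yes; no; does)
open import Relation.Nullary.Decidable using (⌊_⌋; T?; toWitness; fromWitness)
open import Relation.Unary using (Decidable)

-- ℕ's _+_ and _*_ are imported only here, so that the ring operations can be used unqualified below.
module _ where
  open import Data.Nat using (_+_; _*_)
  open CommutativeSemigroupProperties ℕₚ.+-commutativeSemigroup using (interchange)

  T⇒≡true : ∀ {b} → T b → b ≡ true
  T⇒≡true = Equivalence.to T-≡

  ¬T⇒≡false : ∀ {b} → ¬ T b → b ≡ false
  ¬T⇒≡false {false} _ = ≡.refl
  ¬T⇒≡false {true} ¬t = ⊥-elim (¬t tt)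

  T-injective : ∀ {a b} → (T a → T b) → (T b → T a) → a ≡ b
  T-injective {false} {false} _ _ = ≡.refl
  T-injective {false} {true}  _ g = ⊥-elim (g tt)
  T-injective {true}  {false} f _ = ⊥-elim (f tt)
  T-injective {true}  {true}  _ _ = ≡.refl

  infix 4 _≡ᵛ_ _≡ˡ_ _∈ᵛ_

  _≡ᵛ_ : ∀ {n} → Vec ℕ n → Vec ℕ n → Bool
  u ≡ᵛ v = ⌊ Vecₚ.≡-dec ℕ._≟_ u v ⌋

  _≡ˡ_ : List ℕ → List ℕ → Bool
  xs ≡ˡ ys = ⌊ Listₚ.≡-dec ℕ._≟_ xs ys ⌋

  ≡ᵛ⇒≡ : ∀ {n} {u v : Vec ℕ n} → T (u ≡ᵛ v) → u ≡ v
  ≡ᵛ⇒≡ {u = u} {v} = toWitness {a? = Vecₚ.≡-dec ℕ._≟_ u v}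

  ≡⇒≡ᵛ : ∀ {n} {u v : Vec ℕ n} → u ≡ v → T (u ≡ᵛ v)
  ≡⇒≡ᵛ {u = u} {v} = fromWitness {a? = Vecₚ.≡-dec ℕ._≟_ u v}

  ≡ˡ⇒≡ : ∀ {xs ys} → T (xs ≡ˡ ys) → xs ≡ ys
  ≡ˡ⇒≡ {xs} {ys} = toWitness {a? = Listₚ.≡-dec ℕ._≟_ xs ys}

  ≡⇒≡ˡ : ∀ {xs ys} → xs ≡ ys → T (xs ≡ˡ ys)
  ≡⇒≡ˡ {xs} {ys} = fromWitness {a? = Listₚ.≡-dec ℕ._≟_ xs ys}

  ≡ˡ-sym : ∀ xs ys → (xs ≡ˡ ys) ≡ (ys ≡ˡ xs)
  ≡ˡ-sym xs ys = T-injective (λ t → ≡⇒≡ˡ (≡.sym (≡ˡ⇒≡ t))) (λ t → ≡⇒≡ˡ (≡.sym (≡ˡ⇒≡ t)))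

  ≡ᵛ-∷ : ∀ {n} j x (v u : Vec ℕ n) → ((j Vec.∷ v) ≡ᵛ (x Vec.∷ u)) ≡ ((j ≡ᵇ x) ∧ (v ≡ᵛ u))
  ≡ᵛ-∷ j x v u = T-injective
    (λ t → let (j≡x , v≡u) = Vecₚ.∷-injective (≡ᵛ⇒≡ t) in
           Equivalence.from T-∧ (ℕₚ.≡⇒≡ᵇ j x j≡x , ≡⇒≡ᵛ v≡u))
    (λ t → let (j≡x , v≡u) = Equivalence.to T-∧ t in
           ≡⇒≡ᵛ (≡.cong₂ Vec._∷_ (ℕₚ.≡ᵇ⇒≡ j x j≡x) (≡ᵛ⇒≡ v≡u)))

  ≡ˡ-∷-head : ∀ x xs ys → ((x ∷ xs) ≡ˡ (x ∷ ys)) ≡ (xs ≡ˡ ys)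
  ≡ˡ-∷-head x xs ys = T-injective (λ t → ≡⇒≡ˡ (proj₂ (Listₚ.∷-injective (≡ˡ⇒≡ t))))
                                  (λ t → ≡⇒≡ˡ (≡.cong (x ∷_) (≡ˡ⇒≡ t)))

  ≡ˡ-∷-≢ : ∀ {x y} xs ys → x ≢ y → ((x ∷ xs) ≡ˡ (y ∷ ys)) ≡ false
  ≡ˡ-∷-≢ xs ys x≢y = ¬T⇒≡false (x≢y ∘ proj₁ ∘ Listₚ.∷-injective ∘ ≡ˡ⇒≡)

  lookup-ext : ∀ {n} {u v : Vec ℕ n} → (∀ x → lookup u x ≡ lookup v x) → u ≡ v
  lookup-ext e = Pointwise-≡⇒≡ (ext e)

  allᵇ⁻ : ∀ {A : Set} (p : A → Bool) {xs} → T (allᵇ p xs) → ∀ {x} → x ∈ xs → T (p x)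
  allᵇ⁻ p t (here ≡.refl) = proj₁ (Equivalence.to T-∧ t)
  allᵇ⁻ p t (there x∈xs)  = allᵇ⁻ p (proj₂ (Equivalence.to T-∧ t)) x∈xs

  allᵇ⁺ : ∀ {A : Set} (p : A → Bool) xs → (∀ {x} → x ∈ xs → T (p x)) → T (allᵇ p xs)
  allᵇ⁺ p []       f = tt
  allᵇ⁺ p (y ∷ xs) f = Equivalence.from T-∧ (f (here ≡.refl) , allᵇ⁺ p xs (f ∘ there))

  _∈ᵛ_ : ∀ {n} → ℕ → Vec ℕ n → Set
  g ∈ᵛ v = ∃[ y ] lookup v y ≡ g

  elemᵇ⁻ : ∀ {n} j (v : Vec ℕ n) → T (elemᵇ j (toList v)) → j ∈ᵛ v
  elemᵇ⁻ j (a Vec.∷ v) t with Equivalence.to T-∨ t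
  ... | inj₁ j≡a = Fin.zero , ≡.sym (ℕₚ.≡ᵇ⇒≡ j a j≡a)
  ... | inj₂ t′ with elemᵇ⁻ j v t′
  ...   | x , e = Fin.suc x , e

  elemᵇ⁺ : ∀ {n} j (v : Vec ℕ n) x → lookup v x ≡ j → T (elemᵇ j (toList v))
  elemᵇ⁺ j (a Vec.∷ v) Fin.zero    e = Equivalence.from T-∨ (inj₁ (ℕₚ.≡⇒≡ᵇ j a (≡.sym e)))
  elemᵇ⁺ j (a Vec.∷ v) (Fin.suc x) e = Equivalence.from T-∨ (inj₂ (elemᵇ⁺ j v x e))

  lookup<len : ∀ {n} (v : Vec ℕ n) x → lookup v x < len v
  lookup<len (a Vec.∷ v) Fin.zero    = ℕₚ.m≤m⊔n (suc a) (len v)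
  lookup<len (a Vec.∷ v) (Fin.suc x) = ℕₚ.<-≤-trans (lookup<len v x) (ℕₚ.m≤n⊔m (suc a) (len v))

  <len⇒≤lookup : ∀ {n} (v : Vec ℕ n) {j} → j < len v → ∃[ x ] j ≤ lookup v x
  <len⇒≤lookup (a Vec.∷ v) j<l with ℕₚ.⊔-sel (suc a) (len v)
  ... | inj₁ e = Fin.zero , ℕₚ.≤-pred (≡.subst (_ <_) e j<l)
  ... | inj₂ e with <len⇒≤lookup v (≡.subst (_ <_) e j<l)
  ...   | x , j≤vx = Fin.suc x , j≤vx

  len≤ : ∀ {n} (v : Vec ℕ n) {b} → (∀ x → lookup v x < b) → len v ≤ b
  len≤ Vec.[]       f = z≤n
  len≤ (a Vec.∷ v) f = ℕₚ.⊔-lub (f Fin.zero) (len≤ v (f ∘ Fin.suc))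

  Face : ∀ {n} → Vec ℕ n → Set
  Face v = ∀ j → j < len v → j ∈ᵛ v

  isFace⇒Face : ∀ {n} (v : Vec ℕ n) → T (isFace v) → Face v
  isFace⇒Face v t j j<l = elemᵇ⁻ j v (allᵇ⁻ _ t (∈-upTo⁺ j<l))

  Face⇒isFace : ∀ {n} (v : Vec ℕ n) → Face v → T (isFace v)
  Face⇒isFace v f = allᵇ⁺ _ (upTo (len v)) λ j∈ →
    let (x , e) = f _ (∈-upTo⁻ j∈) in elemᵇ⁺ _ v x e

  Face⇒len≤ : ∀ {n} (v : Vec ℕ n) → Face v → len v ≤ n
  Face⇒len≤ v f = Finₚ.injective⇒≤ {f = block} block-injective
    where
    block : Fin (len v) → Fin _
    block i = proj₁ (f (toℕ i) (Finₚ.toℕ<n i))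
    block-injective : ∀ {i j} → block i ≡ block j → i ≡ j
    block-injective {i} {j} e = Finₚ.toℕ-injective (≡.trans (≡.sym (proj₂ (f (toℕ i) (Finₚ.toℕ<n i))))
      (≡.trans (≡.cong (lookup v) e) (proj₂ (f (toℕ j) (Finₚ.toℕ<n j)))))

  Face⇒bounded : ∀ {n} (v : Vec ℕ n) → Face v → AllV.All (_< n) v
  Face⇒bounded v f = AllVₚ.lookup⁻ λ x → ℕₚ.<-≤-trans (lookup<len v x) (Face⇒len≤ v f)

  isFace⇒len≤ : ∀ {k} (G : Vec ℕ k) → T (isFace G) → len G ≤ k
  isFace⇒len≤ G t = Face⇒len≤ G (isFace⇒Face G t)

  ∈-faces⁻ : ∀ {n} {G : Vec ℕ n} → G ∈ faces n → Face G
  ∈-faces⁻ {G = G} G∈ = isFace⇒Face G (proj₂ (∈-filter⁻ (λ v → T? (isFace v)) {xs = vecs _ _} G∈))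

  vecs-bounded : ∀ {m b} {v : Vec ℕ m} → v ∈ vecs m b → AllV.All (_< b) v
  vecs-bounded {zero} {v = Vec.[]} _ = AllV.[]
  vecs-bounded {suc m} {b} v∈ with find (∈-concatMap⁻ (λ j → map (j Vec.∷_) (vecs m b)) {xs = upTo b} v∈)
  ... | j , j∈ , v∈′ with ∈-map⁻ (j Vec.∷_) v∈′
  ...   | w , w∈ , ≡.refl = ∈-upTo⁻ j∈ AllV.∷ vecs-bounded w∈

  _⪯_ : ∀ {n} → Vec ℕ n → Vec ℕ n → Set
  F ⪯ G = ∀ x y → lookup F x ≡ lookup F y → lookup G x ≡ lookup G y

  ⪯ᵇ⇒⪯ : ∀ {n} (F G : Vec ℕ n) → T (F ⪯ᵇ G) → F ⪯ G
  ⪯ᵇ⇒⪯ F G t x y e with Equivalence.to T-∨ (allᵇ⁻ _ (allᵇ⁻ _ t (∈-allFin x)) (∈-allFin y))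
  ... | inj₂ t′ = ℕₚ.≡ᵇ⇒≡ _ _ t′
  ... | inj₁ t′ = ⊥-elim (≡.subst (T ∘ not) (T⇒≡true (ℕₚ.≡⇒≡ᵇ _ _ e)) t′)

  ⪯⇒⪯ᵇ : ∀ {n} (F G : Vec ℕ n) → F ⪯ G → T (F ⪯ᵇ G)
  ⪯⇒⪯ᵇ {n} F G F⪯G = allᵇ⁺ _ (allFin n) λ {x} _ → allᵇ⁺ _ (allFin n) λ {y} _ → pair x y
    where
    pair : ∀ x y → T (not (lookup F x ≡ᵇ lookup F y) ∨ (lookup G x ≡ᵇ lookup G y))
    pair x y with lookup F x ≡ᵇ lookup F y in e
    ... | false = tt
    ... | true  = ℕₚ.≡⇒≡ᵇ _ _ (F⪯G x y (ℕₚ.≡ᵇ⇒≡ _ _ (≡.subst T (≡.sym e) tt)))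

  OrderPreserving : ∀ {n} → Vec ℕ n → Vec ℕ n → Set
  OrderPreserving F H = ∀ x y → lookup F x < lookup F y → lookup H x < lookup H y

  module _ {n} {F H : Vec ℕ n} (face : Face F) (mono : OrderPreserving F H) where

    lookup-mono : ∀ x → lookup F x ≤ lookup H x
    lookup-mono x = go (lookup F x) x ≡.refl
      where
      go : ∀ j x → lookup F x ≡ j → j ≤ lookup H x
      go zero    x e = z≤n
      go (suc j) x e with face j (ℕₚ.<-trans (ℕₚ.n<1+n j) (≡.subst (_< len F) e (lookup<len F x)))
      ... | y , ey = ℕₚ.≤-<-trans (go j y ey) (mono y x (≡.subst₂ _<_ (≡.sym ey) (≡.sym e) (ℕₚ.n<1+n j)))

    lookup+len-mono : ∀ x → lookup H x + len F ≤ lookup F x + len H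
    lookup+len-mono x = go (len F ∸ suc (lookup F x)) x (ℕₚ.m+[n∸m]≡n (lookup<len F x))
      where
      open ℕₚ.≤-Reasoning
      go : ∀ d x → suc (lookup F x) + d ≡ len F → lookup H x + len F ≤ lookup F x + len H
      go zero x e = begin
        lookup H x + len F             ≡⟨ ≡.cong (lookup H x +_) (≡.trans (≡.sym e) (ℕₚ.+-identityʳ _)) ⟩
        lookup H x + suc (lookup F x)  ≡⟨ ℕₚ.+-suc (lookup H x) _ ⟩
        suc (lookup H x) + lookup F x  ≡⟨ ℕₚ.+-comm (suc (lookup H x)) _ ⟩
        lookup F x + suc (lookup H x)  ≤⟨ ℕₚ.+-monoʳ-≤ (lookup F x) (lookup<len H x) ⟩
        lookup F x + len H             ∎
      go (suc d) x e with face (suc (lookup F x)) (≡.subst (suc (lookup F x) <_) e (ℕₚ.m<m+n (suc (lookup F x)) (s≤s z≤n)))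
      ... | y , ey = ℕₚ.≤-pred (begin
        suc (lookup H x) + len F  ≤⟨ ℕₚ.+-monoˡ-≤ (len F) (mono x y (≡.subst (_ <_) (≡.sym ey) ℕₚ.≤-refl)) ⟩
        lookup H y + len F        ≤⟨ go d y (≡.trans (≡.cong (λ z → suc z + d) ey) (≡.trans (≡.sym (ℕₚ.+-suc _ d)) e)) ⟩
        lookup F y + len H        ≡⟨ ≡.cong (_+ len H) ey ⟩
        suc (lookup F x) + len H  ∎)

    len≤⇒≡ : len H ≤ len F → H ≡ F
    len≤⇒≡ le = lookup-ext λ x → ℕₚ.≤-antisym
      (ℕₚ.+-cancelʳ-≤ (len F) _ _ (ℕₚ.≤-trans (lookup+len-mono x) (ℕₚ.+-monoʳ-≤ (lookup F x) le)))
      (lookup-mono x)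

    ≢⇒len< : ¬ H ≡ F → len F < len H
    ≢⇒len< H≢F with ℕₚ.≤-<-connex (len H) (len F)
    ... | inj₁ le = ⊥-elim (H≢F (len≤⇒≡ le))
    ... | inj₂ lt = lt

  OrderPreserving-antisym : ∀ {n} {F H : Vec ℕ n} → Face F → Face H →
                            OrderPreserving F H → OrderPreserving H F → H ≡ F
  OrderPreserving-antisym {F = F} {H} fF fH F↗H H↗F =
    lookup-ext λ x → ℕₚ.≤-antisym (lookup-mono {F = H} {H = F} fH H↗F x) (lookup-mono {F = F} {H = H} fF F↗H x)

  -- The local definitions of _·ᶠ_, so that F ·ᶠ G is definitionally Vec.map (rank (keys F G)) (keys F G).
  keys : ∀ {n} → Vec ℕ n → Vec ℕ n → Vec ℕ n
  keys {n} F G = Vec.zipWith (λ a b → a * n + b) F G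

  rank : ∀ {n} → Vec ℕ n → ℕ → ℕ
  rank K k = length (filter (λ j → T? (elemᵇ j (toList K))) (upTo k))

  rank-suc : ∀ {n} (K : Vec ℕ n) k → rank K (suc k) ≡ rank K k + (if elemᵇ k (toList K) then 1 else 0)
  rank-suc K k = begin
    rank K (suc k)                                        ≡⟨ ≡.cong (length ∘ filter P?) (≡.sym (Listₚ.upTo-∷ʳ k)) ⟩
    length (filter P? (upTo k ++ k ∷ []))       ≡⟨ ≡.cong length (Listₚ.filter-++ P? (upTo k) (k ∷ [])) ⟩
    length (filter P? (upTo k) ++ filter P? (k ∷ []))  ≡⟨ Listₚ.length-++ (filter P? (upTo k)) ⟩
    rank K k + length (filter P? (k ∷ []))                ≡⟨ ≡.cong (rank K k +_) last ⟩
    rank K k + (if elemᵇ k (toList K) then 1 else 0)      ∎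
    where
    open ≡.≡-Reasoning
    P? = λ j → T? (elemᵇ j (toList K))
    last : length (filter P? (k ∷ [])) ≡ (if elemᵇ k (toList K) then 1 else 0)
    last with elemᵇ k (toList K)
    ... | true  = ≡.refl
    ... | false = ≡.refl

  rank-suc-∈ : ∀ {n} (K : Vec ℕ n) {k} → T (elemᵇ k (toList K)) → rank K (suc k) ≡ suc (rank K k)
  rank-suc-∈ K {k} t = ≡.trans (rank-suc K k)
    (≡.trans (≡.cong (λ b → rank K k + (if b then 1 else 0)) (T⇒≡true t)) (ℕₚ.+-comm (rank K k) 1))

  rank-suc-∉ : ∀ {n} (K : Vec ℕ n) {k} → ¬ T (elemᵇ k (toList K)) → rank K (suc k) ≡ rank K k
  rank-suc-∉ K {k} ¬t = ≡.trans (rank-suc K k)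
    (≡.trans (≡.cong (λ b → rank K k + (if b then 1 else 0)) (¬T⇒≡false ¬t)) (ℕₚ.+-identityʳ (rank K k)))

  rank-≤-suc : ∀ {n} (K : Vec ℕ n) k → rank K k ≤ rank K (suc k)
  rank-≤-suc K k with T? (elemᵇ k (toList K))
  ... | yes t = ≡.subst (rank K k ≤_) (≡.sym (rank-suc-∈ K t)) (ℕₚ.n≤1+n (rank K k))
  ... | no ¬t = ℕₚ.≤-reflexive (≡.sym (rank-suc-∉ K ¬t))

  rank-mono : ∀ {n} (K : Vec ℕ n) {k k′} → k ≤ k′ → rank K k ≤ rank K k′
  rank-mono K {k′ = zero}   z≤n = ℕₚ.≤-refl
  rank-mono K {k′ = suc k′} k≤ with ℕₚ.m≤n⇒m<n∨m≡n k≤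
  ... | inj₁ k<  = ℕₚ.≤-trans (rank-mono K (ℕₚ.≤-pred k<)) (rank-≤-suc K k′)
  ... | inj₂ k≡ = ℕₚ.≤-reflexive (≡.cong (rank K) k≡)

  rank-< : ∀ {n} (K : Vec ℕ n) {k k′} → k < k′ → T (elemᵇ k (toList K)) → rank K k < rank K k′
  rank-< K {k} k< t = ℕₚ.<-≤-trans (≡.subst (rank K k <_) (≡.sym (rank-suc-∈ K t)) (ℕₚ.n<1+n _)) (rank-mono K k<)

  rank-surjective : ∀ {n} (K : Vec ℕ n) k {j} → j < rank K k → ∃[ y ] lookup K y < k × rank K (lookup K y) ≡ j
  rank-surjective K (suc k) {j} j< with T? (elemᵇ k (toList K))
  ... | no ¬t = let (y , y< , e) = rank-surjective K k (≡.subst (j <_) (rank-suc-∉ K ¬t) j<) in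
                y , ℕₚ.m<n⇒m<1+n y< , e
  ... | yes t with ℕₚ.m≤n⇒m<n∨m≡n (ℕₚ.≤-pred (≡.subst (j <_) (rank-suc-∈ K t) j<))
  ...   | inj₁ j<r = let (y , y< , e) = rank-surjective K k j<r in y , ℕₚ.m<n⇒m<1+n y< , e
  ...   | inj₂ j≡r = let (y , e) = elemᵇ⁻ k K t in
                     y , ≡.subst (_< suc k) (≡.sym e) ℕₚ.≤-refl , ≡.trans (≡.cong (rank K) e) (≡.sym j≡r)

  module Product {n} (F G : Vec ℕ n) (G<n : AllV.All (_< n) G) where

    K : Vec ℕ n
    K = keys F G

    lookup-keys : ∀ x → lookup K x ≡ lookup F x * n + lookup G x
    lookup-keys x = Vecₚ.lookup-zipWith _ x F G

    lookup-· : ∀ x → lookup (F ·ᶠ G) x ≡ rank K (lookup K x)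
    lookup-· x = Vecₚ.lookup-map x (rank K) K

    keys-< : ∀ {x y} → lookup F x < lookup F y → lookup K x < lookup K y
    keys-< {x} {y} lt = ≡.subst₂ _<_ (≡.sym (lookup-keys x)) (≡.sym (lookup-keys y)) (begin-strict
      lookup F x * n + lookup G x  <⟨ ℕₚ.+-monoʳ-< (lookup F x * n) (AllVₚ.lookup⁺ G<n x) ⟩
      lookup F x * n + n           ≡⟨ ℕₚ.+-comm (lookup F x * n) n ⟩
      suc (lookup F x) * n         ≤⟨ ℕₚ.*-monoˡ-≤ n lt ⟩
      lookup F y * n               ≤⟨ ℕₚ.m≤m+n _ _ ⟩
      lookup F y * n + lookup G y  ∎)
      where open ℕₚ.≤-Reasoning

    keys-injective : ∀ {x y} → lookup K x ≡ lookup K y → lookup F x ≡ lookup F y × lookup G x ≡ lookup G y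
    keys-injective {x} {y} e with ℕₚ.<-cmp (lookup F x) (lookup F y)
    ... | tri< lt _ _ = ⊥-elim (ℕₚ.<-irrefl e (keys-< lt))
    ... | tri> _ _ gt = ⊥-elim (ℕₚ.<-irrefl (≡.sym e) (keys-< gt))
    ... | tri≈ _ Fx≡Fy _ = Fx≡Fy , ℕₚ.+-cancelˡ-≡ (lookup F x * n) _ _
            (≡.trans (≡.sym (lookup-keys x)) (≡.trans e (≡.trans (lookup-keys y) (≡.cong (λ z → z * n + lookup G y) (≡.sym Fx≡Fy)))))

    keys-<⇒·-< : ∀ {x y} → lookup K x < lookup K y → lookup (F ·ᶠ G) x < lookup (F ·ᶠ G) y
    keys-<⇒·-< {x} {y} lt = ≡.subst₂ _<_ (≡.sym (lookup-· x)) (≡.sym (lookup-· y)) (rank-< K lt (elemᵇ⁺ _ K x ≡.refl))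

    ·-≡⇒keys-≡ : ∀ {x y} → lookup (F ·ᶠ G) x ≡ lookup (F ·ᶠ G) y → lookup K x ≡ lookup K y
    ·-≡⇒keys-≡ {x} {y} e with ℕₚ.<-cmp (lookup K x) (lookup K y)
    ... | tri< lt _ _ = ⊥-elim (ℕₚ.<-irrefl e (keys-<⇒·-< lt))
    ... | tri≈ _ eq _ = eq
    ... | tri> _ _ gt = ⊥-elim (ℕₚ.<-irrefl (≡.sym e) (keys-<⇒·-< gt))

    ·-<⇒keys-< : ∀ {x y} → lookup (F ·ᶠ G) x < lookup (F ·ᶠ G) y → lookup K x < lookup K y
    ·-<⇒keys-< {x} {y} lt with ℕₚ.<-cmp (lookup K x) (lookup K y)
    ... | tri< kx<ky _ _ = kx<ky
    ... | tri≈ _ eq _ = ⊥-elim (ℕₚ.<-irrefl (≡.trans (lookup-· x) (≡.trans (≡.cong (rank K) eq) (≡.sym (lookup-· y)))) lt)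
    ... | tri> _ _ gt = ⊥-elim (ℕₚ.<-asym lt (keys-<⇒·-< gt))

    ·-orderPreserving : OrderPreserving F (F ·ᶠ G)
    ·-orderPreserving x y = keys-<⇒·-< ∘ keys-<

    ·-face : Face (F ·ᶠ G)
    ·-face j j< with <len⇒≤lookup (F ·ᶠ G) j<
    ... | x , j≤ with ℕₚ.m≤n⇒m<n∨m≡n j≤
    ...   | inj₂ j≡ = x , ≡.sym j≡
    ...   | inj₁ j<′ = let (y , _ , e) = rank-surjective K (lookup K x) (≡.subst (j <_) (lookup-· x) j<′) in
                       y , ≡.trans (lookup-· y) e

    ·≡⇒⪯ : F ·ᶠ G ≡ F → F ⪯ G
    ·≡⇒⪯ FG≡F x y e = proj₂ (keys-injective (·-≡⇒keys-≡ (≡.subst (λ H → lookup H x ≡ lookup H y) (≡.sym FG≡F) e)))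

    ⪯⇒·≡ : Face F → F ⪯ G → F ·ᶠ G ≡ F
    ⪯⇒·≡ fF F⪯G = OrderPreserving-antisym fF ·-face ·-orderPreserving reflect
      where
      reflect : OrderPreserving (F ·ᶠ G) F
      reflect x y lt with ℕₚ.<-cmp (lookup F x) (lookup F y) | ·-<⇒keys-< lt
      ... | tri< Fx<Fy _ _ | _ = Fx<Fy
      ... | tri≈ _ eq _ | kx<ky = ⊥-elim (ℕₚ.<-irrefl (≡.trans (lookup-keys x)
              (≡.trans (≡.cong₂ (λ a b → a * n + b) eq (F⪯G x y eq)) (≡.sym (lookup-keys y)))) kx<ky)
      ... | tri> _ _ gt | kx<ky = ⊥-elim (ℕₚ.<-asym kx<ky (keys-< gt))

  module _ {n} (F G K : Vec ℕ n) (fF : Face F) (fG : Face G) (fK : Face K) where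
    private
      module FG  = Product F G (Face⇒bounded G fG)
      module FGK = Product (F ·ᶠ G) K (Face⇒bounded K fK)
      module FK  = Product F K (Face⇒bounded K fK)

    ·ᶠ·ᶠ-face : Face ((F ·ᶠ G) ·ᶠ K)
    ·ᶠ·ᶠ-face = FGK.·-face

    ·ᶠ·ᶠ≡⇒⪯ : (F ·ᶠ G) ·ᶠ K ≡ F → F ⪯ G × F ⪯ K
    ·ᶠ·ᶠ≡⇒⪯ FGK≡F = FG.·≡⇒⪯ FG≡F , FK.·≡⇒⪯ (≡.trans (≡.cong (_·ᶠ K) (≡.sym FG≡F)) FGK≡F)
      where
      FG≡F : F ·ᶠ G ≡ F
      FG≡F = OrderPreserving-antisym fF FG.·-face FG.·-orderPreserving
               (≡.subst (OrderPreserving (F ·ᶠ G)) FGK≡F FGK.·-orderPreserving)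

    ⪯⇒·ᶠ·ᶠ≡ : F ⪯ G → F ⪯ K → (F ·ᶠ G) ·ᶠ K ≡ F
    ⪯⇒·ᶠ·ᶠ≡ F⪯G F⪯K = ≡.trans (≡.cong (_·ᶠ K) (FG.⪯⇒·≡ fF F⪯G)) (FK.⪯⇒·≡ fF F⪯K)

    ·ᶠ·ᶠ≢⇒len< : ¬ (F ·ᶠ G) ·ᶠ K ≡ F → len F < len ((F ·ᶠ G) ·ᶠ K)
    ·ᶠ·ᶠ≢⇒len< = ≢⇒len< fF (λ x y → FGK.·-orderPreserving x y ∘ FG.·-orderPreserving x y)

  -- Permutations with a prescribed descent set, and compositions

  -- The largest (b = true) or smallest (b = false) value is put in front, so the descents are the positions of U.
  withDescents : ∀ {m} → Vec Bool m → Permutation′ (suc m)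
  withDescents {zero}  Vec.[]       = Perm.id
  withDescents {suc m} (b Vec.∷ U) = insert Fin.zero (if b then Fin.fromℕ (suc m) else Fin.zero) (withDescents U)

  toℕ-punchIn-fromℕ : ∀ k (x : Fin (suc k)) → toℕ (Fin.punchIn (Fin.fromℕ (suc k)) x) ≡ toℕ x
  toℕ-punchIn-fromℕ k       Fin.zero    = ≡.refl
  toℕ-punchIn-fromℕ (suc k) (Fin.suc x) = ≡.cong suc (toℕ-punchIn-fromℕ k x)

  oneLine-withDescents-true : ∀ {m} (U : Vec Bool m) →
    oneLine (withDescents (true Vec.∷ U)) ≡ suc m ∷ oneLine (withDescents U)
  oneLine-withDescents-true {m} U = ≡.cong₂ _∷_ (Finₚ.toℕ-fromℕ (suc m))
    (≡.cong toList (Vecₚ.tabulate-cong λ i → toℕ-punchIn-fromℕ m (withDescents U ⟨$⟩ʳ i)))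

  oneLine-withDescents-false : ∀ {m} (U : Vec Bool m) →
    oneLine (withDescents (false Vec.∷ U)) ≡ 0 ∷ map suc (oneLine (withDescents U))
  oneLine-withDescents-false U = ≡.cong (0 ∷_)
    (≡.trans (≡.cong toList (Vecₚ.tabulate-∘ suc (λ i → toℕ (withDescents U ⟨$⟩ʳ i)))) (Vecₚ.toList-map suc _))

  positions : ∀ {m} → ℕ → Vec Bool m → List ℕ
  positions k Vec.[]           = []
  positions k (true  Vec.∷ U) = k ∷ positions (suc k) U
  positions k (false Vec.∷ U) = positions (suc k) U

  desFrom-map-suc : ∀ k xs → desFrom k (map suc xs) ≡ desFrom k xs
  desFrom-map-suc k []           = ≡.refl
  desFrom-map-suc k (a ∷ [])     = ≡.refl
  desFrom-map-suc k (a ∷ b ∷ xs) = ≡.cong ((if b <ᵇ a then k ∷ [] else []) ++_) (desFrom-map-suc (suc k) (b ∷ xs))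

  desFrom-descent : ∀ k {a b} xs → b < a → desFrom k (a ∷ b ∷ xs) ≡ k ∷ desFrom (suc k) (b ∷ xs)
  desFrom-descent k {b = b} xs b<a =
    ≡.cong (λ d → (if d then k ∷ [] else []) ++ desFrom (suc k) (b ∷ xs)) (T⇒≡true (ℕₚ.<⇒<ᵇ b<a))

  desFrom-withDescents : ∀ {m} k (U : Vec Bool m) → desFrom k (oneLine (withDescents U)) ≡ positions k U
  desFrom-withDescents {zero}  k Vec.[] = ≡.refl
  desFrom-withDescents {suc m} k (true Vec.∷ U) = begin
    desFrom k (oneLine (withDescents (true Vec.∷ U)))  ≡⟨ ≡.cong (desFrom k) (oneLine-withDescents-true U) ⟩
    desFrom k (suc m ∷ oneLine (withDescents U))
      ≡⟨ desFrom-descent k (toList (tabulate (λ x → toℕ (withDescents U ⟨$⟩ʳ Fin.suc x)))) (Finₚ.toℕ<n _) ⟩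
    k ∷ desFrom (suc k) (oneLine (withDescents U))     ≡⟨ ≡.cong (k ∷_) (desFrom-withDescents (suc k) U) ⟩
    k ∷ positions (suc k) U                            ∎
    where open ≡.≡-Reasoning
  desFrom-withDescents {suc m} k (false Vec.∷ U) = begin
    desFrom k (oneLine (withDescents (false Vec.∷ U)))  ≡⟨ ≡.cong (desFrom k) (oneLine-withDescents-false U) ⟩
    desFrom (suc k) (map suc (oneLine (withDescents U)))  ≡⟨ desFrom-map-suc (suc k) (oneLine (withDescents U)) ⟩
    desFrom (suc k) (oneLine (withDescents U))            ≡⟨ desFrom-withDescents (suc k) U ⟩
    positions (suc k) U                                   ∎
    where open ≡.≡-Reasoning

  full : ∀ {m} → Vec Bool m → Bool
  full Vec.[]       = true
  full (b Vec.∷ U) = b ∧ full U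

  oneLine-withDescents-full : ∀ {m} (U : Vec Bool m) → T (full U) → oneLine (withDescents U) ≡ downFrom (suc m)
  oneLine-withDescents-full {zero}  Vec.[]          _ = ≡.refl
  oneLine-withDescents-full {suc m} (true Vec.∷ U) t =
    ≡.trans (oneLine-withDescents-true U) (≡.cong (suc m ∷_) (oneLine-withDescents-full U t))

  oneLine-withDescents-downFrom : ∀ {m} (U : Vec Bool m) → oneLine (withDescents U) ≡ downFrom (suc m) → T (full U)
  oneLine-withDescents-downFrom {zero}  Vec.[] _ = tt
  oneLine-withDescents-downFrom {suc m} (true Vec.∷ U) e =
    oneLine-withDescents-downFrom U (proj₂ (Listₚ.∷-injective (≡.trans (≡.sym (oneLine-withDescents-true U)) e)))
  oneLine-withDescents-downFrom {suc m} (false Vec.∷ U) e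
    with () ← proj₁ (Listₚ.∷-injective (≡.trans (≡.sym (oneLine-withDescents-false U)) e))

  isW₀-withDescents : ∀ {m} (U : Vec Bool m) → isW₀ᵇ (withDescents U) ≡ full U
  isW₀-withDescents {m} U = T-injective
    (λ t → oneLine-withDescents-downFrom U (≡.trans (toWitness t) (Listₚ.reverse-upTo (suc m))))
    (λ t → fromWitness (≡.trans (oneLine-withDescents-full U t) (≡.sym (Listₚ.reverse-upTo (suc m)))))

  subsets : (m : ℕ) → List (Vec Bool m)
  subsets zero    = Vec.[] ∷ []
  subsets (suc m) = map (true Vec.∷_) (subsets m) ++ map (false Vec.∷_) (subsets m)

  _⊆ᵇ_ : ∀ {m} → Vec Bool m → Vec Bool m → Bool
  Vec.[]       ⊆ᵇ Vec.[]       = true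
  (u Vec.∷ U) ⊆ᵇ (v Vec.∷ V) = (not u ∨ v) ∧ (U ⊆ᵇ V)

  -- toComposition t V is the composition β of t + m + 1 with D(β) = {t + i | V i} (positions of V counted from 1).
  toComposition : ∀ {m} → ℕ → Vec Bool m → List ℕ
  toComposition t Vec.[]           = suc t ∷ []
  toComposition t (true  Vec.∷ V) = suc t ∷ toComposition 0 V
  toComposition t (false Vec.∷ V) = toComposition (suc t) V

  #true : ∀ {m} → Vec Bool m → ℕ
  #true Vec.[]           = 0
  #true (true  Vec.∷ V) = suc (#true V)
  #true (false Vec.∷ V) = #true V

  #false : ∀ {m} → Vec Bool m → ℕ
  #false Vec.[]           = 0
  #false (true  Vec.∷ V) = #false V
  #false (false Vec.∷ V) = suc (#false V)

  incHead-toComposition : ∀ {m} t (V : Vec Bool m) → incHead (toComposition t V) ≡ toComposition (suc t) V ∷ []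
  incHead-toComposition t Vec.[]           = ≡.refl
  incHead-toComposition t (true  Vec.∷ V) = ≡.refl
  incHead-toComposition t (false Vec.∷ V) = incHead-toComposition (suc t) V

  comps≡map-toComposition : ∀ m → comps (suc m) ≡ map (toComposition 0) (subsets m)
  comps≡map-toComposition zero    = ≡.refl
  comps≡map-toComposition (suc m) = begin
    map (1 ∷_) (comps (suc m)) ++ concatMap incHead (comps (suc m))
      ≡⟨ ≡.cong (λ C → map (1 ∷_) C ++ concatMap incHead C) (comps≡map-toComposition m) ⟩
    map (1 ∷_) (map (toComposition 0) S) ++ concatMap incHead (map (toComposition 0) S)
      ≡⟨ ≡.cong₂ _++_ (≡.sym (Listₚ.map-∘ S)) (concatMap-incHead S) ⟩
    map (toComposition 0 ∘ (true Vec.∷_)) S ++ map (toComposition 0 ∘ (false Vec.∷_)) S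
      ≡⟨ ≡.cong₂ _++_ (Listₚ.map-∘ S) (Listₚ.map-∘ S) ⟩
    map (toComposition 0) (map (true Vec.∷_) S) ++ map (toComposition 0) (map (false Vec.∷_) S)
      ≡⟨ ≡.sym (Listₚ.map-++ (toComposition 0) (map (true Vec.∷_) S) _) ⟩
    map (toComposition 0) (subsets (suc m)) ∎
    where
    open ≡.≡-Reasoning
    S = subsets m
    concatMap-incHead : ∀ Vs → concatMap incHead (map (toComposition 0) Vs) ≡ map (toComposition 1) Vs
    concatMap-incHead []       = ≡.refl
    concatMap-incHead (V ∷ Vs) = ≡.cong₂ _++_ (incHead-toComposition 0 V) (concatMap-incHead Vs)

  partialSums-∷ : ∀ {m} s a t (V : Vec Bool m) →
    partialSums s (a ∷ toComposition t V) ≡ (s + a) ∷ partialSums (s + a) (toComposition t V)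
  partialSums-∷ s a t Vec.[]           = ≡.refl
  partialSums-∷ s a t (true  Vec.∷ V) = ≡.refl
  partialSums-∷ s a t (false Vec.∷ V) = partialSums-∷ s a (suc t) V

  partialSums-toComposition : ∀ {m} s t (V : Vec Bool m) → partialSums s (toComposition t V) ≡ positions (s + suc t) V
  partialSums-toComposition s t Vec.[]           = ≡.refl
  partialSums-toComposition s t (true  Vec.∷ V) = ≡.trans (partialSums-∷ s (suc t) 0 V)
    (≡.cong ((s + suc t) ∷_) (≡.trans (partialSums-toComposition (s + suc t) 0 V) (≡.cong (λ k → positions k V) (ℕₚ.+-comm _ 1))))
  partialSums-toComposition s t (false Vec.∷ V) = ≡.trans (partialSums-toComposition s (suc t) V)
    (≡.cong (λ k → positions k V) (ℕₚ.+-suc s (suc t)))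

  elemᵇ-positions-< : ∀ {m} {i k} (W : Vec Bool m) → i < k → elemᵇ i (positions k W) ≡ false
  elemᵇ-positions-< Vec.[]           i<k = ≡.refl
  elemᵇ-positions-< (true  Vec.∷ W) i<k =
    ≡.cong₂ _∨_ (¬T⇒≡false (ℕₚ.<⇒≢ i<k ∘ ℕₚ.≡ᵇ⇒≡ _ _)) (elemᵇ-positions-< W (ℕₚ.m<n⇒m<1+n i<k))
  elemᵇ-positions-< (false Vec.∷ W) i<k = elemᵇ-positions-< W (ℕₚ.m<n⇒m<1+n i<k)

  elemᵇ-positions-head : ∀ {m} k w (W : Vec Bool m) → elemᵇ k (positions k (w Vec.∷ W)) ≡ w
  elemᵇ-positions-head k true  W = ≡.cong (_∨ elemᵇ k (positions (suc k) W)) (T⇒≡true (ℕₚ.≡⇒≡ᵇ k k ≡.refl))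
  elemᵇ-positions-head k false W = elemᵇ-positions-< W ℕₚ.≤-refl

  elemᵇ-positions-tail : ∀ {m} {i k} w (W : Vec Bool m) → k < i → elemᵇ i (positions k (w Vec.∷ W)) ≡ elemᵇ i (positions (suc k) W)
  elemᵇ-positions-tail false W k<i = ≡.refl
  elemᵇ-positions-tail {i = i} {k} true W k<i =
    ≡.cong (_∨ elemᵇ i (positions (suc k) W)) (¬T⇒≡false (ℕₚ.>⇒≢ k<i ∘ ℕₚ.≡ᵇ⇒≡ _ _))

  allᵇ-positions-cong : ∀ {m} {p q : ℕ → Bool} k (U : Vec Bool m) → (∀ {i} → k ≤ i → p i ≡ q i) →
                        allᵇ p (positions k U) ≡ allᵇ q (positions k U)
  allᵇ-positions-cong k Vec.[]           p≗q = ≡.refl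
  allᵇ-positions-cong k (true  Vec.∷ U) p≗q =
    ≡.cong₂ _∧_ (p≗q ℕₚ.≤-refl) (allᵇ-positions-cong (suc k) U (p≗q ∘ ℕₚ.<⇒≤))
  allᵇ-positions-cong k (false Vec.∷ U) p≗q = allᵇ-positions-cong (suc k) U (p≗q ∘ ℕₚ.<⇒≤)

  positions-⊆ᵇ : ∀ {m} k (U V : Vec Bool m) → allᵇ (λ i → elemᵇ i (positions k V)) (positions k U) ≡ U ⊆ᵇ V
  positions-⊆ᵇ k Vec.[] Vec.[] = ≡.refl
  positions-⊆ᵇ k (true Vec.∷ U) (v Vec.∷ V) = ≡.cong₂ _∧_ (elemᵇ-positions-head k v V)
    (≡.trans (allᵇ-positions-cong (suc k) U (elemᵇ-positions-tail v V)) (positions-⊆ᵇ (suc k) U V))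
  positions-⊆ᵇ k (false Vec.∷ U) (v Vec.∷ V) =
    ≡.trans (allᵇ-positions-cong (suc k) U (elemᵇ-positions-tail v V)) (positions-⊆ᵇ (suc k) U V)

  desSub-withDescents : ∀ {m} (U V : Vec Bool m) → desSubᵇ (withDescents U) (toComposition 0 V) ≡ U ⊆ᵇ V
  desSub-withDescents U V = ≡.trans
    (≡.cong₂ (λ D′ Des′ → allᵇ (λ i → elemᵇ i D′) Des′) (partialSums-toComposition 0 0 V) (desFrom-withDescents 1 U))
    (positions-⊆ᵇ 1 U V)

  length-toComposition : ∀ {m} t (V : Vec Bool m) → length (toComposition t V) ≡ suc (#true V)
  length-toComposition t Vec.[]           = ≡.refl
  length-toComposition t (true  Vec.∷ V) = ≡.cong suc (length-toComposition 0 V)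
  length-toComposition t (false Vec.∷ V) = length-toComposition (suc t) V

  #true+#false : ∀ {m} (V : Vec Bool m) → #true V + #false V ≡ m
  #true+#false Vec.[]           = ≡.refl
  #true+#false (true  Vec.∷ V) = ≡.cong suc (#true+#false V)
  #true+#false (false Vec.∷ V) = ≡.trans (ℕₚ.+-suc _ _) (≡.cong suc (#true+#false V))

  #false≡∸length : ∀ {m} (V : Vec Bool m) → #false V ≡ suc m ∸ length (toComposition 0 V)
  #false≡∸length {m} V = ≡.sym (begin
    suc m ∸ length (toComposition 0 V)  ≡⟨ ≡.cong (suc m ∸_) (length-toComposition 0 V) ⟩
    m ∸ #true V                          ≡⟨ ≡.cong (_∸ #true V) (≡.sym (#true+#false V)) ⟩
    #true V + #false V ∸ #true V         ≡⟨ ℕₚ.m+n∸m≡n (#true V) (#false V) ⟩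
    #false V                             ∎)
    where open ≡.≡-Reasoning

  head-toComposition : ∀ {m} t (V : Vec Bool m) → ∃[ a ] ∃[ r ] toComposition t V ≡ a ∷ r × suc t ≤ a
  head-toComposition t Vec.[]           = suc t , [] , ≡.refl , ℕₚ.≤-refl
  head-toComposition t (true  Vec.∷ V) = suc t , toComposition 0 V , ≡.refl , ℕₚ.≤-refl
  head-toComposition t (false Vec.∷ V) with head-toComposition (suc t) V
  ... | a , r , e , t<a = a , r , e , ℕₚ.<⇒≤ t<a

  length-type : ∀ {n} (G : Vec ℕ n) → length (type G) ≡ len G
  length-type G = ≡.trans (Listₚ.length-map _ (upTo (len G))) (Listₚ.length-upTo (len G))

  countᵇ-∷ : ∀ i x xs → countᵇ i (x ∷ xs) ≡ (if i ≡ᵇ x then 1 else 0) + countᵇ i xs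
  countᵇ-∷ i x xs with i ≡ᵇ x
  ... | true  = ≡.refl
  ... | false = ≡.refl

  countᵇ-pos : ∀ {n} (G : Vec ℕ n) x → 1 ≤ countᵇ (lookup G x) (toList G)
  countᵇ-pos (a Vec.∷ G) Fin.zero rewrite countᵇ-∷ a a (toList G) | T⇒≡true (ℕₚ.≡⇒≡ᵇ a a ≡.refl) = s≤s z≤n
  countᵇ-pos (a Vec.∷ G) (Fin.suc x) rewrite countᵇ-∷ (lookup G x) a (toList G) =
    ℕₚ.≤-trans (countᵇ-pos G x) (ℕₚ.m≤n+m _ _)

  sum-upTo-suc : ∀ (f : ℕ → ℕ) L → sum (map f (upTo (suc L))) ≡ sum (map f (upTo L)) + f L
  sum-upTo-suc f L = begin
    sum (map f (upTo (suc L)))              ≡⟨ ≡.cong (sum ∘ map f) (≡.sym (Listₚ.upTo-∷ʳ L)) ⟩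
    sum (map f (upTo L ++ L ∷ []))          ≡⟨ ≡.cong sum (Listₚ.map-++ f (upTo L) (L ∷ [])) ⟩
    sum (map f (upTo L) ++ f L ∷ [])        ≡⟨ Sumₚ.sum-++ (map f (upTo L)) (f L ∷ []) ⟩
    sum (map f (upTo L)) + (f L + 0)        ≡⟨ ≡.cong (sum (map f (upTo L)) +_) (ℕₚ.+-identityʳ (f L)) ⟩
    sum (map f (upTo L)) + f L              ∎
    where open ≡.≡-Reasoning

  sum-map-+ : ∀ (f g : ℕ → ℕ) xs → sum (map (λ i → f i + g i) xs) ≡ sum (map f xs) + sum (map g xs)
  sum-map-+ f g []       = ≡.refl
  sum-map-+ f g (x ∷ xs) = ≡.trans (≡.cong (f x + g x +_) (sum-map-+ f g xs)) (interchange (f x) (g x) _ _)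

  sum-upTo-zero : ∀ (f : ℕ → ℕ) L → (∀ {i} → i < L → f i ≡ 0) → sum (map f (upTo L)) ≡ 0
  sum-upTo-zero f zero    _ = ≡.refl
  sum-upTo-zero f (suc L) f≡0 = ≡.trans (sum-upTo-suc f L)
    (≡.cong₂ _+_ (sum-upTo-zero f L (f≡0 ∘ ℕₚ.m<n⇒m<1+n)) (f≡0 ℕₚ.≤-refl))

  sum-upTo-indicator : ∀ {a} L → a < L → sum (map (λ i → if i ≡ᵇ a then 1 else 0) (upTo L)) ≡ 1
  sum-upTo-indicator {a} (suc L) a< rewrite sum-upTo-suc (λ i → if i ≡ᵇ a then 1 else 0) L
    with ℕₚ.m≤n⇒m<n∨m≡n (ℕₚ.≤-pred a<)
  ... | inj₁ a<L rewrite sum-upTo-indicator L a<L | ¬T⇒≡false (ℕₚ.>⇒≢ a<L ∘ ℕₚ.≡ᵇ⇒≡ L a) = ≡.refl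
  ... | inj₂ ≡.refl rewrite sum-upTo-zero (λ i → if i ≡ᵇ a then 1 else 0) L
                             (λ i<a → ≡.cong (λ b → if b then 1 else 0) (¬T⇒≡false (ℕₚ.<⇒≢ i<a ∘ ℕₚ.≡ᵇ⇒≡ _ a)))
                         | T⇒≡true (ℕₚ.≡⇒≡ᵇ a a ≡.refl) = ≡.refl

  sum-countᵇ : ∀ {n} (G : Vec ℕ n) L → (∀ x → lookup G x < L) → sum (map (λ i → countᵇ i (toList G)) (upTo L)) ≡ n
  sum-countᵇ Vec.[]       L G<L = sum-upTo-zero _ L (λ _ → ≡.refl)
  sum-countᵇ {suc n} (a Vec.∷ G) L G<L = begin
    sum (map (λ i → countᵇ i (a ∷ toList G)) (upTo L))
      ≡⟨ ≡.cong sum (Listₚ.map-cong (λ i → countᵇ-∷ i a (toList G)) (upTo L)) ⟩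
    sum (map (λ i → (if i ≡ᵇ a then 1 else 0) + countᵇ i (toList G)) (upTo L))
      ≡⟨ sum-map-+ _ _ (upTo L) ⟩
    sum (map (λ i → if i ≡ᵇ a then 1 else 0) (upTo L)) + sum (map (λ i → countᵇ i (toList G)) (upTo L))
      ≡⟨ ≡.cong₂ _+_ (sum-upTo-indicator L (G<L Fin.zero)) (sum-countᵇ G L (G<L ∘ Fin.suc)) ⟩
    1 + n ∎
    where open ≡.≡-Reasoning

  type-isComposition : ∀ {n} {G : Vec ℕ n} → Face G → IsComposition n (type G)
  type-isComposition {G = G} face = Allₚ.map⁺ (Allₚ.applyUpTo⁺₁ _ (len G) block-nonempty) , sum-countᵇ G (len G) (lookup<len G)
    where
    block-nonempty : ∀ {i} → i < len G → 1 ≤ countᵇ i (toList G)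
    block-nonempty i< = let (x , e) = face _ i< in ≡.subst (λ i → 1 ≤ countᵇ i (toList G)) e (countᵇ-pos G x)

  Onto : ∀ {n} → ℕ → Vec ℕ n → Set
  Onto L v = (∀ x → lookup v x < L) × (∀ j → j < L → j ∈ᵛ v)

  Onto⇒len≡ : ∀ {n} {L} (v : Vec ℕ n) → Onto L v → len v ≡ L
  Onto⇒len≡ {L = zero}  v (v<L , _)    = ℕₚ.n≤0⇒n≡0 (len≤ v v<L)
  Onto⇒len≡ {L = suc L} v (v<L , onto) = let (x , e) = onto L ℕₚ.≤-refl in
    ℕₚ.≤-antisym (len≤ v v<L) (≡.subst (_< len v) e (lookup<len v x))

  Onto⇒Face : ∀ {n} {L} (v : Vec ℕ n) → Onto L v → Face v
  Onto⇒Face v o j j< = proj₂ o j (≡.subst (j <_) (Onto⇒len≡ v o) j<)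

  Face⇒Onto : ∀ {n} (v : Vec ℕ n) → Face v → Onto (len v) v
  Face⇒Onto v face = lookup<len v , face

  Onto-∷⁻ : ∀ {n} {L g} (G : Vec ℕ n) → Onto L (g Vec.∷ G) → g ∈ᵛ G → Onto L G × g < L
  Onto-∷⁻ G (g∷G<L , onto) (y , Gy≡g) = (g∷G<L ∘ Fin.suc , onto′) , g∷G<L Fin.zero
    where
    onto′ : ∀ j → j < _ → j ∈ᵛ G
    onto′ j j< with onto j j<
    ... | Fin.zero  , e = y , ≡.trans Gy≡g e
    ... | Fin.suc x , e = x , e

  Onto-∷⁺ : ∀ {n} {L g} (G : Vec ℕ n) → Onto L G → g < L → Onto L (g Vec.∷ G) × g ∈ᵛ G
  Onto-∷⁺ G (G<L , onto) g<L = ((λ { Fin.zero → g<L ; (Fin.suc x) → G<L x }) ,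
    (λ j j< → let (x , e) = onto j j< in Fin.suc x , e)) , onto _ g<L

  -- gap g frees the block index g by shifting the indices ≥ g up; close g undoes this away from g.
  gap : ℕ → ℕ → ℕ
  gap g x = if x <ᵇ g then x else suc x

  close : ℕ → ℕ → ℕ
  close g x = if x <ᵇ g then x else ℕ.pred x

  module _ {g x : ℕ} where

    gap-< : x < g → gap g x ≡ x
    gap-< x<g = ≡.cong (if_then x else suc x) (T⇒≡true (ℕₚ.<⇒<ᵇ x<g))

    gap-≥ : g ≤ x → gap g x ≡ suc x
    gap-≥ g≤x = ≡.cong (if_then x else suc x) (¬T⇒≡false (ℕₚ.≤⇒≯ g≤x ∘ ℕₚ.<ᵇ⇒< x g))

    close-< : x < g → close g x ≡ x
    close-< x<g = ≡.cong (if_then x else ℕ.pred x) (T⇒≡true (ℕₚ.<⇒<ᵇ x<g))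

    close-≥ : g ≤ x → close g x ≡ ℕ.pred x
    close-≥ g≤x = ≡.cong (if_then x else ℕ.pred x) (¬T⇒≡false (ℕₚ.≤⇒≯ g≤x ∘ ℕₚ.<ᵇ⇒< x g))

  close-gap : ∀ g x → close g (gap g x) ≡ x
  close-gap g x with ℕₚ.<-≤-connex x g
  ... | inj₁ x<g = ≡.trans (≡.cong (close g) (gap-< x<g)) (close-< x<g)
  ... | inj₂ g≤x = ≡.trans (≡.cong (close g) (gap-≥ g≤x)) (close-≥ (ℕₚ.m≤n⇒m≤1+n g≤x))

  gap-close : ∀ g x → x ≢ g → gap g (close g x) ≡ x
  gap-close g x x≢g with ℕₚ.<-cmp x g
  ... | tri< x<g _ _ = ≡.trans (≡.cong (gap g) (close-< x<g)) (gap-< x<g)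
  ... | tri≈ _ x≡g _ = ⊥-elim (x≢g x≡g)
  gap-close g (suc x) _ | tri> _ _ (s≤s g≤x) = ≡.trans (≡.cong (gap g) (close-≥ (ℕₚ.m≤n⇒m≤1+n g≤x))) (gap-≥ g≤x)

  gap≢ : ∀ g x → gap g x ≢ g
  gap≢ g x with ℕₚ.<-≤-connex x g
  ... | inj₁ x<g = λ e → ℕₚ.<⇒≢ x<g (≡.trans (≡.sym (gap-< x<g)) e)
  ... | inj₂ g≤x = λ e → ℕₚ.<⇒≢ (s≤s g≤x) (≡.sym (≡.trans (≡.sym (gap-≥ g≤x)) e))

  Onto-singleton⁻ : ∀ {n} {L g} (G : Vec ℕ n) → Onto (suc L) (g Vec.∷ G) → ¬ g ∈ᵛ G →
                    Onto L (Vec.map (close g) G) × g ≤ L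
  Onto-singleton⁻ {L = L} {g} G (g∷G< , onto) g∉G = (bounded , onto′) , ℕₚ.≤-pred (g∷G< Fin.zero)
    where
    pred< : ∀ {a} → 0 < a → a < suc L → ℕ.pred a < L
    pred< {suc a} _ (s≤s a<L) = a<L
    lookup-close : ∀ x → lookup (Vec.map (close g) G) x ≡ close g (lookup G x)
    lookup-close x = Vecₚ.lookup-map x (close g) G
    bounded : ∀ x → lookup (Vec.map (close g) G) x < L
    bounded x rewrite lookup-close x with ℕₚ.<-cmp (lookup G x) g | g∷G< (Fin.suc x)
    ... | tri< Gx<g _ _ | _ = ≡.subst (_< L) (≡.sym (close-< Gx<g)) (ℕₚ.<-≤-trans Gx<g (ℕₚ.≤-pred (g∷G< Fin.zero)))
    ... | tri≈ _ Gx≡g _ | _ = ⊥-elim (g∉G (x , Gx≡g))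
    ... | tri> _ _ g<Gx | Gx<1+L = ≡.subst (_< L) (≡.sym (close-≥ (ℕₚ.<⇒≤ g<Gx)))
                                     (pred< (ℕₚ.≤-<-trans z≤n g<Gx) Gx<1+L)
    onto′ : ∀ j → j < L → j ∈ᵛ Vec.map (close g) G
    onto′ j j<L with ℕₚ.<-≤-connex j g
    ... | inj₁ j<g with onto j (ℕₚ.m<n⇒m<1+n j<L)
    ...   | Fin.zero  , g≡j = ⊥-elim (ℕₚ.<⇒≢ j<g (≡.sym g≡j))
    ...   | Fin.suc x , e   = x , ≡.trans (lookup-close x) (≡.trans (≡.cong (close g) e) (close-< j<g))
    onto′ j j<L | inj₂ g≤j with onto (suc j) (s≤s j<L)
    ...   | Fin.zero  , g≡1+j = ⊥-elim (ℕₚ.<⇒≢ (s≤s g≤j) g≡1+j)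
    ...   | Fin.suc x , e     = x , ≡.trans (lookup-close x) (≡.trans (≡.cong (close g) e) (close-≥ (ℕₚ.m≤n⇒m≤1+n g≤j)))

  Onto-singleton⁺ : ∀ {n} {L g} (G : Vec ℕ n) → Onto L G → g ≤ L →
                    Onto (suc L) (g Vec.∷ Vec.map (gap g) G) × ¬ g ∈ᵛ Vec.map (gap g) G
  Onto-singleton⁺ {L = L} {g} G (G<L , onto) g≤L =
    (bounded , onto′) , λ (y , e) → gap≢ g (lookup G y) (≡.trans (≡.sym (lookup-gap y)) e)
    where
    lookup-gap : ∀ x → lookup (Vec.map (gap g) G) x ≡ gap g (lookup G x)
    lookup-gap x = Vecₚ.lookup-map x (gap g) G
    bounded : ∀ x → lookup (g Vec.∷ Vec.map (gap g) G) x < suc L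
    bounded Fin.zero = s≤s g≤L
    bounded (Fin.suc x) rewrite lookup-gap x with ℕₚ.<-≤-connex (lookup G x) g
    ... | inj₁ Gx<g = ≡.subst (_< suc L) (≡.sym (gap-< Gx<g)) (ℕₚ.m<n⇒m<1+n (G<L x))
    ... | inj₂ g≤Gx = ≡.subst (_< suc L) (≡.sym (gap-≥ g≤Gx)) (s≤s (G<L x))
    onto′ : ∀ j → j < suc L → j ∈ᵛ (g Vec.∷ Vec.map (gap g) G)
    onto′ j j< with ℕₚ.<-cmp j g
    ... | tri≈ _ j≡g _ = Fin.zero , ≡.sym j≡g
    ... | tri< j<g _ _ = let (y , e) = onto j (ℕₚ.<-≤-trans j<g g≤L) in
                         Fin.suc y , ≡.trans (lookup-gap y) (≡.trans (≡.cong (gap g) e) (gap-< j<g))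
    onto′ (suc j) (s≤s j<L) | tri> _ _ (s≤s g≤j) = let (y , e) = onto j j<L in
                         Fin.suc y , ≡.trans (lookup-gap y) (≡.trans (≡.cong (gap g) e) (gap-≥ g≤j))

  -- A face of [k+1] whose first element is a singleton block is encoded by the index g of that block
  -- followed by the face of the remaining k elements obtained by closing the gap at g.
  isSharedHeadFace : ∀ {k} → Vec ℕ (suc k) → Bool
  isSharedHeadFace G = isFace G ∧ elemᵇ (Vec.head G) (toList (Vec.tail G))

  closeHead : ∀ {k} → Vec ℕ (suc k) → Vec ℕ (suc k)
  closeHead (g Vec.∷ G) = g Vec.∷ Vec.map (close g) G

  openHead : ∀ {k} → Vec ℕ (suc k) → Vec ℕ (suc k)
  openHead (g Vec.∷ G) = g Vec.∷ Vec.map (gap g) G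

  isSingletonHeadFace : ∀ {k} → Vec ℕ (suc k) → Bool
  isSingletonHeadFace G = isFace G ∧ not (elemᵇ (Vec.head G) (toList (Vec.tail G)))

  isHeadPlacement : ∀ {k} → Vec ℕ (suc k) → Bool
  isHeadPlacement G = isFace (Vec.tail G) ∧ (Vec.head G <ᵇ suc (len (Vec.tail G)))

  len-∷≡suc : ∀ {k} g (G : Vec ℕ k) → len (g Vec.∷ G) ≡ suc (len (g Vec.∷ G) ∸ 1)
  len-∷≡suc g G = ≡.sym (ℕₚ.m+[n∸m]≡n {1} (ℕₚ.≤-trans (s≤s z≤n) (lookup<len (g Vec.∷ G) Fin.zero)))

  singleton-head : ∀ {k} g (G : Vec ℕ k) → T (isSingletonHeadFace (g Vec.∷ G)) →
    Onto (len (g Vec.∷ G) ∸ 1) (Vec.map (close g) G) × g ≤ len (g Vec.∷ G) ∸ 1 × ¬ g ∈ᵛ G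
  singleton-head g G t with Equivalence.to T-∧ t
  ... | face , g∉G = let g∉G′ = λ ((y , e) : g ∈ᵛ G) → ≡.subst T (Equivalence.to T-not-≡ g∉G) (elemᵇ⁺ g G y e)
                         (onto , g≤) = Onto-singleton⁻ G (≡.subst (λ L → Onto L (g Vec.∷ G)) (len-∷≡suc g G)
                                         (Face⇒Onto (g Vec.∷ G) (isFace⇒Face (g Vec.∷ G) face))) g∉G′
                     in onto , g≤ , g∉G′

  closeHead-inverse : ∀ {k} {v : Vec ℕ (suc k)} → AllV.All (_< suc k) v → T (isSingletonHeadFace v) →
    AllV.All (_< suc k) (closeHead v) × T (isHeadPlacement (closeHead v)) × openHead (closeHead v) ≡ v
  closeHead-inverse {k} {g Vec.∷ G} (g< AllV.∷ _) t with singleton-head g G t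
  ... | onto , g≤ , g∉G = (g< AllV.∷ AllVₚ.lookup⁻ λ x → ℕₚ.<-≤-trans (proj₁ onto x) (ℕₚ.m≤n⇒m≤1+n L≤k)) ,
    Equivalence.from T-∧ (Face⇒isFace G′ (Onto⇒Face G′ onto) ,
                          ℕₚ.<⇒<ᵇ (s≤s (≡.subst (g ≤_) (≡.sym (Onto⇒len≡ G′ onto)) g≤))) ,
    ≡.cong (g Vec.∷_) (lookup-ext λ x → ≡.trans (Vecₚ.lookup-map x (gap g) G′)
      (≡.trans (≡.cong (gap g) (Vecₚ.lookup-map x (close g) G)) (gap-close g (lookup G x) λ e → g∉G (x , e))))
    where
    G′ = Vec.map (close g) G
    L≤k : len (g Vec.∷ G) ∸ 1 ≤ k
    L≤k = ℕₚ.≤-pred (≡.subst (_≤ suc k) (len-∷≡suc g G) (isFace⇒len≤ (g Vec.∷ G) (proj₁ (Equivalence.to T-∧ t))))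

  openHead-inverse : ∀ {k} {w : Vec ℕ (suc k)} → AllV.All (_< suc k) w → T (isHeadPlacement w) →
    AllV.All (_< suc k) (openHead w) × T (isSingletonHeadFace (openHead w)) × closeHead (openHead w) ≡ w
  openHead-inverse {k} {g Vec.∷ G} _ t with Equivalence.to T-∧ t
  ... | face , g< with Onto-singleton⁺ G (Face⇒Onto G (isFace⇒Face G face)) (ℕₚ.≤-pred (ℕₚ.<ᵇ⇒< g _ g<))
  ...   | onto , g∉ = let G′ = Vec.map (gap g) G ; face′ = Onto⇒Face (g Vec.∷ G′) onto in
    Face⇒bounded (g Vec.∷ G′) face′ ,
    Equivalence.from T-∧ (Face⇒isFace (g Vec.∷ G′) face′ , Equivalence.from T-not-≡ (¬T⇒≡false (g∉ ∘ elemᵇ⁻ g G′))) ,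
    ≡.cong (g Vec.∷_) (lookup-ext λ x → ≡.trans (Vecₚ.lookup-map x (close g) G′)
      (≡.trans (≡.cong (close g) (Vecₚ.lookup-map x (gap g) G)) (close-gap g (lookup G x))))

  len-singleton-head : ∀ {k} (G : Vec ℕ (suc k)) → T (isSingletonHeadFace G) → len G ≡ suc (len (Vec.tail (closeHead G)))
  len-singleton-head (g Vec.∷ G) t =
    ≡.trans (len-∷≡suc g G) (≡.cong suc (≡.sym (Onto⇒len≡ (Vec.map (close g) G) (proj₁ (singleton-head g G t)))))

  Onto-transfer : ∀ {n k L} {u : Vec ℕ n} {v : Vec ℕ k} → Onto L v →
                  (∀ x → ∃[ i ] lookup u x ≡ lookup v i) → (∀ i → ∃[ x ] lookup v i ≡ lookup u x) → Onto L u
  Onto-transfer (v<L , onto) u⊆v v⊆u =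
    (λ x → let (i , e) = u⊆v x in ≡.subst (_< _) (≡.sym e) (v<L i)) ,
    (λ j j< → let (i , e) = onto j j< ; (x , e′) = v⊆u i in x , ≡.trans (≡.sym e′) e)

  module Coarsening {n} (F : Vec ℕ n) (face : Face F) where

    rep : Fin (len F) → Fin n
    rep i = proj₁ (face (toℕ i) (Finₚ.toℕ<n i))

    lookup-rep : ∀ i → lookup F (rep i) ≡ toℕ i
    lookup-rep i = proj₂ (face (toℕ i) (Finₚ.toℕ<n i))

    block : Fin n → Fin (len F)
    block x = Fin.fromℕ< (lookup<len F x)

    toℕ-block : ∀ x → toℕ (block x) ≡ lookup F x
    toℕ-block x = Finₚ.toℕ-fromℕ< (lookup<len F x)

    block-rep : ∀ i → block (rep i) ≡ i
    block-rep i = Finₚ.toℕ-injective (≡.trans (toℕ-block (rep i)) (lookup-rep i))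

    collapse : Vec ℕ n → Vec ℕ (len F)
    collapse G = tabulate (lookup G ∘ rep)

    expand : Vec ℕ (len F) → Vec ℕ n
    expand H = tabulate (lookup H ∘ block)

    lookup-collapse : ∀ G i → lookup (collapse G) i ≡ lookup G (rep i)
    lookup-collapse G = Vecₚ.lookup∘tabulate (lookup G ∘ rep)

    lookup-expand : ∀ H x → lookup (expand H) x ≡ lookup H (block x)
    lookup-expand H = Vecₚ.lookup∘tabulate (lookup H ∘ block)

    lookup-rep-block : ∀ {G} → F ⪯ G → ∀ x → lookup G (rep (block x)) ≡ lookup G x
    lookup-rep-block F⪯G x = F⪯G _ _ (≡.trans (lookup-rep (block x)) (toℕ-block x))

    expand-collapse : ∀ {G} → F ⪯ G → expand (collapse G) ≡ G
    expand-collapse {G} F⪯G = lookup-ext λ x →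
      ≡.trans (lookup-expand (collapse G) x) (≡.trans (lookup-collapse G (block x)) (lookup-rep-block {G} F⪯G x))

    collapse-expand : ∀ H → collapse (expand H) ≡ H
    collapse-expand H = lookup-ext λ i →
      ≡.trans (lookup-collapse (expand H) i) (≡.trans (lookup-expand H (rep i)) (≡.cong (lookup H) (block-rep i)))

    ⪯-expand : ∀ H → F ⪯ expand H
    ⪯-expand H x y Fx≡Fy = ≡.trans (lookup-expand H x) (≡.trans
      (≡.cong (lookup H) (Finₚ.toℕ-injective (≡.trans (toℕ-block x) (≡.trans Fx≡Fy (≡.sym (toℕ-block y))))))
      (≡.sym (lookup-expand H y)))

    Onto-collapse : ∀ {G L} → F ⪯ G → Onto L G → Onto L (collapse G)
    Onto-collapse {G} F⪯G o = Onto-transfer {u = collapse G} {v = G} o (λ i → rep i , lookup-collapse G i)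
      (λ x → block x , ≡.trans (≡.sym (lookup-rep-block {G} F⪯G x)) (≡.sym (lookup-collapse G (block x))))

    Onto-expand : ∀ {H L} → Onto L H → Onto L (expand H)
    Onto-expand {H} o = Onto-transfer {u = expand H} {v = H} o (λ x → block x , lookup-expand H x)
      (λ i → rep i , ≡.trans (≡.cong (lookup H) (≡.sym (block-rep i))) (≡.sym (lookup-expand H (rep i))))

    Onto-collapse-face : ∀ {G} → T (isFace G ∧ (F ⪯ᵇ G)) → Onto (len G) (collapse G)
    Onto-collapse-face {G} t = let (faceG , F⪯G) = Equivalence.to T-∧ t in
      Onto-collapse {G} (⪯ᵇ⇒⪯ F G F⪯G) (Face⇒Onto G (isFace⇒Face G faceG))

    len-collapse : ∀ {G} → T (isFace G ∧ (F ⪯ᵇ G)) → len (collapse G) ≡ len G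
    len-collapse {G} t = Onto⇒len≡ (collapse G) (Onto-collapse-face {G} t)

    collapse-inverse : ∀ {G} → T (isFace G ∧ (F ⪯ᵇ G)) →
                       AllV.All (_< len F) (collapse G) × T (isFace (collapse G)) × expand (collapse G) ≡ G
    collapse-inverse {G} t = let face′ = Onto⇒Face (collapse G) (Onto-collapse-face {G} t) in
      Face⇒bounded (collapse G) face′ , Face⇒isFace (collapse G) face′ ,
      expand-collapse {G} (⪯ᵇ⇒⪯ F G (proj₂ (Equivalence.to T-∧ t)))

    expand-inverse : ∀ {H} → T (isFace H) →
                     AllV.All (_< n) (expand H) × T (isFace (expand H) ∧ (F ⪯ᵇ expand H)) × collapse (expand H) ≡ H
    expand-inverse {H} t = let face′ = Onto⇒Face (expand H) (Onto-expand {H} (Face⇒Onto H (isFace⇒Face H t))) in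
      Face⇒bounded (expand H) face′ ,
      Equivalence.from T-∧ (Face⇒isFace (expand H) face′ , ⪯⇒⪯ᵇ F (expand H) (⪯-expand H)) ,
      collapse-expand H

module _ {c ℓ} (R : CommutativeRing c ℓ) where

  open CommutativeRing R hiding (zero)
  open RingProperties ring using (-0#≈0#; -1*x≈-x; -‿distribˡ-*; -‿distribʳ-*)
  open CommutativeSemigroupProperties +-commutativeSemigroup using (interchange)
  open import Relation.Binary.Reasoning.Setoid setoid

  ∑ : ∀ {a} {A : Set a} → List A → (A → Carrier) → Carrier
  ∑ xs f = Σsum R (map f xs)

  syntax ∑ xs (λ x → e) = ∑[ x ∈ xs ] e

  when : Bool → Carrier → Carrier
  when b x = if b then x else 0#

  private
    variable
      a b : Level
      A : Set a
      B : Set b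

  ∑-++ : ∀ (xs ys : List A) f → ∑ (xs ++ ys) f ≈ ∑ xs f + ∑ ys f
  ∑-++ []       ys f = sym (+-identityˡ _)
  ∑-++ (x ∷ xs) ys f = trans (+-congˡ (∑-++ xs ys f)) (sym (+-assoc _ _ _))

  ∑-map : ∀ (g : A → B) xs f → ∑ (map g xs) f ≡ ∑ xs (f ∘ g)
  ∑-map g []       f = ≡.refl
  ∑-map g (x ∷ xs) f = ≡.cong (f (g x) +_) (∑-map g xs f)

  ∑-concatMap : ∀ (h : A → List B) xs f → ∑ (concatMap h xs) f ≈ ∑[ x ∈ xs ] ∑ (h x) f
  ∑-concatMap h []       f = refl
  ∑-concatMap h (x ∷ xs) f = trans (∑-++ (h x) (concatMap h xs) f) (+-congˡ (∑-concatMap h xs f))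

  ∑-cong∈ : ∀ (xs : List A) {f g} → (∀ {x} → x ∈ xs → f x ≈ g x) → ∑ xs f ≈ ∑ xs g
  ∑-cong∈ []       f≈g = refl
  ∑-cong∈ (x ∷ xs) f≈g = +-cong (f≈g (here ≡.refl)) (∑-cong∈ xs (f≈g ∘ there))

  ∑-cong : ∀ (xs : List A) {f g} → (∀ x → f x ≈ g x) → ∑ xs f ≈ ∑ xs g
  ∑-cong xs f≈g = ∑-cong∈ xs λ {x} _ → f≈g x

  ∑-zero∈ : ∀ (xs : List A) {f} → (∀ {x} → x ∈ xs → f x ≈ 0#) → ∑ xs f ≈ 0#
  ∑-zero∈ []       f≈0 = refl
  ∑-zero∈ (x ∷ xs) f≈0 = trans (+-cong (f≈0 (here ≡.refl)) (∑-zero∈ xs (f≈0 ∘ there))) (+-identityˡ 0#)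

  ∑-zero : ∀ (xs : List A) {f} → (∀ x → f x ≈ 0#) → ∑ xs f ≈ 0#
  ∑-zero xs f≈0 = ∑-zero∈ xs λ {x} _ → f≈0 x

  ∑-+ : ∀ (xs : List A) f g → ∑[ x ∈ xs ] (f x + g x) ≈ ∑ xs f + ∑ xs g
  ∑-+ []       f g = sym (+-identityˡ 0#)
  ∑-+ (x ∷ xs) f g = trans (+-congˡ (∑-+ xs f g)) (interchange (f x) (g x) _ _)

  ∑-*ˡ : ∀ (xs : List A) k f → ∑[ x ∈ xs ] (k * f x) ≈ k * ∑ xs f
  ∑-*ˡ []       k f = sym (zeroʳ k)
  ∑-*ˡ (x ∷ xs) k f = trans (+-congˡ (∑-*ˡ xs k f)) (sym (distribˡ k _ _))

  ∑-*ʳ : ∀ (xs : List A) k f → ∑[ x ∈ xs ] (f x * k) ≈ ∑ xs f * k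
  ∑-*ʳ xs k f = trans (∑-cong xs λ _ → *-comm _ k) (trans (∑-*ˡ xs k f) (*-comm k _))

  ∑-neg : ∀ (xs : List A) f → ∑[ x ∈ xs ] (- f x) ≈ - ∑ xs f
  ∑-neg xs f = trans (∑-cong xs λ _ → sym (-1*x≈-x _)) (trans (∑-*ˡ xs (- 1#) f) (-1*x≈-x _))

  ∑-comm : ∀ (xs : List A) (ys : List B) (h : A → B → Carrier) →
           ∑[ x ∈ xs ] ∑[ y ∈ ys ] h x y ≈ ∑[ y ∈ ys ] ∑[ x ∈ xs ] h x y
  ∑-comm []       ys h = sym (∑-zero ys λ _ → refl)
  ∑-comm (x ∷ xs) ys h = trans (+-congˡ (∑-comm xs ys h)) (sym (∑-+ ys (h x) _))

  ∑-filter : ∀ {p} {P : A → Set p} (P? : Decidable P) xs f → ∑ (filter P? xs) f ≈ ∑[ x ∈ xs ] when (does (P? x)) (f x)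
  ∑-filter P? []       f = refl
  ∑-filter P? (x ∷ xs) f with does (P? x)
  ... | true  = +-congˡ (∑-filter P? xs f)
  ... | false = trans (∑-filter P? xs f) (sym (+-identityˡ _))

  ∑-when : ∀ (xs : List A) b f → ∑[ x ∈ xs ] when b (f x) ≈ when b (∑ xs f)
  ∑-when xs true  f = refl
  ∑-when xs false f = ∑-zero xs λ _ → refl

  fromℕ-length : ∀ (xs : List A) → fromℕ R (length xs) ≈ ∑[ _ ∈ xs ] 1#
  fromℕ-length []       = refl
  fromℕ-length (x ∷ xs) = +-congˡ (fromℕ-length xs)

  when-*ʳ : ∀ b x y → x * when b y ≈ when b (x * y)
  when-*ʳ true  x y = refl
  when-*ʳ false x y = zeroʳ x

  when-∧ : ∀ a b x → when a (when b x) ≡ when (a ∧ b) x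
  when-∧ true  b x = ≡.refl
  when-∧ false b x = ≡.refl

  when-cong : ∀ b {x y} → x ≈ y → when b x ≈ when b y
  when-cong true  x≈y = x≈y
  when-cong false x≈y = refl

  when-0 : ∀ b → when b 0# ≈ 0#
  when-0 true  = refl
  when-0 false = refl

  when-+ : ∀ b x y → when b (x + y) ≈ when b x + when b y
  when-+ true  x y = refl
  when-+ false x y = sym (+-identityˡ 0#)

  when-neg : ∀ b x → when b (- x) ≈ - when b x
  when-neg true  x = refl
  when-neg false x = sym -0#≈0#

  when-split : ∀ a b x → when a x ≈ when (a ∧ b) x + when (a ∧ not b) x
  when-split true  true  x = sym (+-identityʳ x)
  when-split true  false x = sym (+-identityˡ x)
  when-split false b     x = sym (+-identityˡ 0#)

  when-comm : ∀ a b {x} → when a (when b x) ≡ when b (when a x)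
  when-comm true  true  = ≡.refl
  when-comm true  false = ≡.refl
  when-comm false true  = ≡.refl
  when-comm false false = ≡.refl

  when-ext : ∀ a b {x y} → (T a → T b × x ≈ y) → (T b → T a) → when a x ≈ when b y
  when-ext true  b a⇒b _ with a⇒b tt
  ... | Tb , x≈y = ≡.subst (λ d → _ ≈ when d _) (≡.sym (T⇒≡true Tb)) x≈y
  when-ext false true  _ b⇒a = ⊥-elim (b⇒a tt)
  when-ext false false _ _   = refl

  ∑-upTo-suc : ∀ b f → ∑ (upTo (suc b)) f ≡ f 0 + ∑[ j ∈ upTo b ] f (suc j)
  ∑-upTo-suc b f = ≡.cong (f 0 +_) (≡.trans (≡.cong (λ xs → ∑ xs f) (≡.sym (Listₚ.map-upTo suc b))) (∑-map suc (upTo b) f))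

  ∑-vecs-∷ : ∀ m b f → ∑ (vecs (suc m) b) f ≈ ∑[ j ∈ upTo b ] ∑[ v ∈ vecs m b ] f (j Vec.∷ v)
  ∑-vecs-∷ m b f = trans (∑-concatMap _ (upTo b) f) (∑-cong (upTo b) λ j → reflexive (∑-map (j Vec.∷_) (vecs m b) f))

  ∑-vecs-cong : ∀ m b {f g} → (∀ {v} → AllV.All (_< b) v → f v ≈ g v) → ∑ (vecs m b) f ≈ ∑ (vecs m b) g
  ∑-vecs-cong m b f≈g = ∑-cong∈ (vecs m b) (f≈g ∘ vecs-bounded)

  ∑-upTo-point : ∀ {a} b (h : ℕ → Carrier) → a < b → ∑[ j ∈ upTo b ] when (j ≡ᵇ a) (h j) ≈ h a
  ∑-upTo-point {zero} (suc b) h _ = begin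
    ∑[ j ∈ upTo (suc b) ] when (j ≡ᵇ 0) (h j)  ≡⟨ ∑-upTo-suc b _ ⟩
    h 0 + ∑[ j ∈ upTo b ] 0#                   ≈⟨ +-congˡ (∑-zero (upTo b) λ _ → refl) ⟩
    h 0 + 0#                                    ≈⟨ +-identityʳ (h 0) ⟩
    h 0                                         ∎
  ∑-upTo-point {suc a} (suc b) h (s≤s a<b) = begin
    ∑[ j ∈ upTo (suc b) ] when (j ≡ᵇ suc a) (h j)   ≡⟨ ∑-upTo-suc b _ ⟩
    0# + ∑[ j ∈ upTo b ] when (j ≡ᵇ a) (h (suc j))  ≈⟨ +-identityˡ _ ⟩
    ∑[ j ∈ upTo b ] when (j ≡ᵇ a) (h (suc j))       ≈⟨ ∑-upTo-point b (h ∘ suc) a<b ⟩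
    h (suc a)                                        ∎

  ∑-vecs-point : ∀ m b {u : Vec ℕ m} (h : Vec ℕ m → Carrier) → AllV.All (_< b) u →
                 ∑[ v ∈ vecs m b ] when (v ≡ᵛ u) (h v) ≈ h u
  ∑-vecs-point zero    b {Vec.[]} h _ = +-identityʳ _
  ∑-vecs-point (suc m) b {x Vec.∷ u} h (x<b AllV.∷ u<b) = begin
    ∑[ v ∈ vecs (suc m) b ] when (v ≡ᵛ (x Vec.∷ u)) (h v)
      ≈⟨ ∑-vecs-∷ m b _ ⟩
    ∑[ j ∈ upTo b ] ∑[ v ∈ vecs m b ] when ((j Vec.∷ v) ≡ᵛ (x Vec.∷ u)) (h (j Vec.∷ v))
      ≈⟨ ∑-cong (upTo b) (λ j → ∑-cong (vecs m b) λ v → reflexive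
           (≡.trans (≡.cong (λ d → when d _) (≡ᵛ-∷ j x v u)) (≡.sym (when-∧ (j ≡ᵇ x) (v ≡ᵛ u) _)))) ⟩
    ∑[ j ∈ upTo b ] ∑[ v ∈ vecs m b ] when (j ≡ᵇ x) (when (v ≡ᵛ u) (h (j Vec.∷ v)))
      ≈⟨ ∑-cong (upTo b) (λ j → trans (∑-when (vecs m b) (j ≡ᵇ x) _) (when-cong (j ≡ᵇ x) (∑-vecs-point m b _ u<b))) ⟩
    ∑[ j ∈ upTo b ] when (j ≡ᵇ x) (h (j Vec.∷ u))
      ≈⟨ ∑-upTo-point b (λ j → h (j Vec.∷ u)) x<b ⟩
    h (x Vec.∷ u) ∎

  ∑-vecs-bijection : ∀ {m m′} b b′ (P : Vec ℕ m → Bool) (Q : Vec ℕ m′ → Bool)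
    (φ : Vec ℕ m → Vec ℕ m′) (ψ : Vec ℕ m′ → Vec ℕ m) (f : Vec ℕ m′ → Carrier) →
    (∀ {v} → AllV.All (_< b) v → T (P v) → AllV.All (_< b′) (φ v) × T (Q (φ v)) × ψ (φ v) ≡ v) →
    (∀ {w} → AllV.All (_< b′) w → T (Q w) → AllV.All (_< b) (ψ w) × T (P (ψ w)) × φ (ψ w) ≡ w) →
    ∑[ v ∈ vecs m b ] when (P v) (f (φ v)) ≈ ∑[ w ∈ vecs m′ b′ ] when (Q w) (f w)
  ∑-vecs-bijection {m} {m′} b b′ P Q φ ψ f φ-ok ψ-ok = begin
    ∑[ v ∈ vecs m b ] when (P v) (f (φ v))
      ≈⟨ ∑-vecs-cong m b (λ v<b → sym (∑-graph v<b)) ⟩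
    ∑[ v ∈ vecs m b ] ∑[ w ∈ vecs m′ b′ ] when (P v ∧ (w ≡ᵛ φ v)) (f w)
      ≈⟨ ∑-comm (vecs m b) (vecs m′ b′) _ ⟩
    ∑[ w ∈ vecs m′ b′ ] ∑[ v ∈ vecs m b ] when (P v ∧ (w ≡ᵛ φ v)) (f w)
      ≈⟨ ∑-vecs-cong m′ b′ (λ w<b′ → ∑-vecs-cong m b λ v<b → reflexive (≡.cong (λ d → when d _) (graph-sym v<b w<b′))) ⟩
    ∑[ w ∈ vecs m′ b′ ] ∑[ v ∈ vecs m b ] when (Q w ∧ (v ≡ᵛ ψ w)) (f w)
      ≈⟨ ∑-vecs-cong m′ b′ ∑-cograph ⟩
    ∑[ w ∈ vecs m′ b′ ] when (Q w) (f w) ∎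
    where
    ∑-graph : ∀ {v} → AllV.All (_< b) v → ∑[ w ∈ vecs m′ b′ ] when (P v ∧ (w ≡ᵛ φ v)) (f w) ≈ when (P v) (f (φ v))
    ∑-graph {v} v<b with P v in Pv
    ... | false = ∑-zero (vecs m′ b′) λ _ → refl
    ... | true  = ∑-vecs-point m′ b′ f (proj₁ (φ-ok v<b (≡.subst T (≡.sym Pv) _)))
    ∑-cograph : ∀ {w} → AllV.All (_< b′) w → ∑[ v ∈ vecs m b ] when (Q w ∧ (v ≡ᵛ ψ w)) (f w) ≈ when (Q w) (f w)
    ∑-cograph {w} w<b′ with Q w in Qw
    ... | false = ∑-zero (vecs m b) λ _ → refl
    ... | true  = ∑-vecs-point m b (λ _ → f w) (proj₁ (ψ-ok w<b′ (≡.subst T (≡.sym Qw) _)))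
    graph-sym : ∀ {v w} → AllV.All (_< b) v → AllV.All (_< b′) w → (P v ∧ (w ≡ᵛ φ v)) ≡ (Q w ∧ (v ≡ᵛ ψ w))
    graph-sym {v} {w} v<b w<b′ = T-injective
      (λ t → let (Pv , w≡φv) = Equivalence.to T-∧ t ; (_ , Qφv , ψφv≡v) = φ-ok v<b Pv in
             ≡.subst (λ w → T (Q w ∧ (v ≡ᵛ ψ w))) (≡.sym (≡ᵛ⇒≡ w≡φv))
               (Equivalence.from T-∧ (Qφv , ≡⇒≡ᵛ (≡.sym ψφv≡v))))
      (λ t → let (Qw , v≡ψw) = Equivalence.to T-∧ t ; (_ , Pψw , φψw≡w) = ψ-ok w<b′ Qw in
             ≡.subst (λ v → T (P v ∧ (w ≡ᵛ φ v))) (≡.sym (≡ᵛ⇒≡ v≡ψw))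
               (Equivalence.from T-∧ (Pψw , ≡⇒≡ᵛ (≡.sym φψw≡w))))

  ∑-upTo-<ᵇ : ∀ b {L} y → L ≤ b → ∑[ g ∈ upTo b ] when (g <ᵇ L) y ≈ fromℕ R L * y
  ∑-upTo-<ᵇ zero          y z≤n = sym (zeroˡ y)
  ∑-upTo-<ᵇ (suc b) {zero}  y _   = trans (reflexive (∑-upTo-suc b _))
    (trans (+-identityˡ _) (trans (∑-zero (upTo b) λ _ → refl) (sym (zeroˡ y))))
  ∑-upTo-<ᵇ (suc b) {suc L} y (s≤s L≤b) = begin
    ∑[ g ∈ upTo (suc b) ] when (g <ᵇ suc L) y  ≡⟨ ∑-upTo-suc b _ ⟩
    y + ∑[ g ∈ upTo b ] when (g <ᵇ L) y        ≈⟨ +-cong (sym (*-identityˡ y)) (∑-upTo-<ᵇ b y L≤b) ⟩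
    1# * y + fromℕ R L * y                     ≈⟨ sym (distribʳ y 1# _) ⟩
    fromℕ R (suc L) * y                        ∎

  -- The coordinates of w₀ and the expansion of w̃₀

  sgn-+ : ∀ a b → sgn R (a ℕ.+ b) ≈ sgn R a * sgn R b
  sgn-+ zero    b = sym (*-identityˡ _)
  sgn-+ (suc a) b = trans (-‿cong (sgn-+ a b)) (-‿distribˡ-* _ _)

  ∑-subsets-suc : ∀ m (f : Vec Bool (suc m) → Carrier) →
    ∑ (subsets (suc m)) f ≈ ∑[ V ∈ subsets m ] f (true Vec.∷ V) + ∑[ V ∈ subsets m ] f (false Vec.∷ V)
  ∑-subsets-suc m f = trans (∑-++ (map (true Vec.∷_) (subsets m)) _ f)
    (reflexive (≡.cong₂ _+_ (∑-map _ (subsets m) f) (∑-map _ (subsets m) f)))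

  ∑-subsets-true : ∀ m U (f : Vec Bool (suc m) → Carrier) →
    ∑[ V ∈ subsets (suc m) ] when ((true Vec.∷ U) ⊆ᵇ V) (f V) ≈ ∑[ V ∈ subsets m ] when (U ⊆ᵇ V) (f (true Vec.∷ V))
  ∑-subsets-true m U f = trans (∑-subsets-suc m _) (trans (+-congˡ (∑-zero (subsets m) λ _ → refl)) (+-identityʳ _))

  upper-sums-vanish : ∀ m (y : Vec Bool m → Carrier) →
    (∀ U → ∑[ V ∈ subsets m ] when (U ⊆ᵇ V) (y V) ≈ 0#) → ∀ V → y V ≈ 0#
  upper-sums-vanish zero    y h Vec.[]       = trans (sym (+-identityʳ _)) (h Vec.[])
  upper-sums-vanish (suc m) y h (b Vec.∷ V) = component b
    where
    y-true≈0 : ∀ V → y (true Vec.∷ V) ≈ 0#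
    y-true≈0 = upper-sums-vanish m (y ∘ (true Vec.∷_)) λ U → trans (sym (∑-subsets-true m U y)) (h (true Vec.∷ U))
    y-both≈0 : ∀ V → y (true Vec.∷ V) + y (false Vec.∷ V) ≈ 0#
    y-both≈0 = upper-sums-vanish m (λ V → y (true Vec.∷ V) + y (false Vec.∷ V)) λ U →
      trans (∑-cong (subsets m) (λ V → when-+ (U ⊆ᵇ V) _ _))
        (trans (∑-+ (subsets m) _ _) (trans (sym (∑-subsets-suc m _)) (h (false Vec.∷ U))))
    component : ∀ b → y (b Vec.∷ V) ≈ 0#
    component true  = y-true≈0 V
    component false = begin
      y (false Vec.∷ V)                      ≈⟨ sym (+-identityˡ _) ⟩
      0# + y (false Vec.∷ V)                 ≈⟨ +-congʳ (sym (y-true≈0 V)) ⟩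
      y (true Vec.∷ V) + y (false Vec.∷ V)  ≈⟨ y-both≈0 V ⟩
      0#                                     ∎

  upper-sums-sgn : ∀ m U → ∑[ V ∈ subsets m ] when (U ⊆ᵇ V) (sgn R (#false V)) ≈ when (full U) 1#
  upper-sums-sgn zero    Vec.[]          = +-identityʳ _
  upper-sums-sgn (suc m) (true Vec.∷ U)  = trans (∑-subsets-true m U _) (upper-sums-sgn m U)
  upper-sums-sgn (suc m) (false Vec.∷ U) = trans (∑-subsets-suc m _) (trans (sym (∑-+ (subsets m) _ _))
    (∑-zero (subsets m) λ V → trans (+-congˡ (when-neg (U ⊆ᵇ V) _)) (-‿inverseʳ _)))

  upper-sums-inversion : ∀ m (x : Vec Bool m → Carrier) →
    (∀ U → ∑[ V ∈ subsets m ] when (U ⊆ᵇ V) (x V) ≈ when (full U) 1#) → ∀ V → x V ≈ sgn R (#false V)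
  upper-sums-inversion m x h V = begin
    x V                          ≈⟨ sym (+-identityʳ _) ⟩
    x V + 0#                     ≈⟨ +-congˡ (sym (-‿inverseˡ s)) ⟩
    x V + (- s + s)              ≈⟨ sym (+-assoc _ _ _) ⟩
    (x V - s) + s                ≈⟨ +-congʳ (upper-sums-vanish m (λ V → x V - sgn R (#false V)) differences-vanish V) ⟩
    0# + s                       ≈⟨ +-identityˡ s ⟩
    s                            ∎
    where
    s = sgn R (#false V)
    differences-vanish : ∀ U → ∑[ V ∈ subsets m ] when (U ⊆ᵇ V) (x V - sgn R (#false V)) ≈ 0#
    differences-vanish U = begin
      ∑[ V ∈ subsets m ] when (U ⊆ᵇ V) (x V - sgn R (#false V))
        ≈⟨ ∑-cong (subsets m) (λ V → trans (when-+ (U ⊆ᵇ V) _ _) (+-congˡ (when-neg (U ⊆ᵇ V) _))) ⟩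
      ∑[ V ∈ subsets m ] (when (U ⊆ᵇ V) (x V) - when (U ⊆ᵇ V) (sgn R (#false V)))
        ≈⟨ trans (∑-+ (subsets m) _ _) (+-congˡ (∑-neg (subsets m) _)) ⟩
      ∑[ V ∈ subsets m ] when (U ⊆ᵇ V) (x V) - ∑[ V ∈ subsets m ] when (U ⊆ᵇ V) (sgn R (#false V))
        ≈⟨ +-cong (h U) (-‿cong (upper-sums-sgn m U)) ⟩
      when (full U) 1# - when (full U) 1#
        ≈⟨ -‿inverseʳ _ ⟩
      0# ∎

  W₀Coords⇒sgn : ∀ m cβ → W₀Coords R (suc m) cβ → ∀ V → cβ (toComposition 0 V) ≈ sgn R (#false V)
  W₀Coords⇒sgn m cβ w₀ = upper-sums-inversion m (cβ ∘ toComposition 0) λ U → begin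
    ∑[ V ∈ subsets m ] when (U ⊆ᵇ V) (cβ (toComposition 0 V))
      ≈⟨ ∑-cong (subsets m) (λ V → reflexive (≡.cong (λ b → when b _) (≡.sym (desSub-withDescents U V)))) ⟩
    ∑[ V ∈ subsets m ] when (desSubᵇ (withDescents U) (toComposition 0 V)) (cβ (toComposition 0 V))
      ≡⟨ ≡.sym (∑-map (toComposition 0) (subsets m) _) ⟩
    ∑[ β ∈ map (toComposition 0) (subsets m) ] when (desSubᵇ (withDescents U) β) (cβ β)
      ≡⟨ ≡.cong (λ C → ∑[ β ∈ C ] when (desSubᵇ (withDescents U) β) (cβ β)) (≡.sym (comps≡map-toComposition m)) ⟩
    ∑[ β ∈ comps (suc m) ] when (desSubᵇ (withDescents U) β) (cβ β)
      ≈⟨ w₀ (withDescents U) ⟩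
    when (isW₀ᵇ (withDescents U)) 1#
      ≡⟨ ≡.cong (λ b → when b 1#) (isW₀-withDescents U) ⟩
    when (full U) 1# ∎

  ∑-toComposition-point : ∀ m t {a r} → suc t ≤ a → All (1 ≤_) r → a ℕ.+ sum r ≡ suc t ℕ.+ m →
                          ∑[ V ∈ subsets m ] when (toComposition t V ≡ˡ (a ∷ r)) 1# ≈ 1#
  ∑-toComposition-point zero t {r = []} t<a _ a≡ rewrite ℕₚ.+-identityʳ (suc t)
    | ≡.trans (≡.sym (ℕₚ.+-identityʳ _)) a≡ | T⇒≡true (≡⇒≡ˡ {suc t ∷ []} ≡.refl) = +-identityʳ 1#
  ∑-toComposition-point zero t {a} {r = b ∷ r} t<a (1≤b ∷ _) a≡ = ⊥-elim (ℕₚ.<-irrefl ≡.refl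
    (ℕₚ.+-cancelˡ-≤ (suc t) 1 0
      (≡.subst (suc t ℕ.+ 1 ≤_) a≡ (ℕₚ.+-mono-≤ t<a (ℕₚ.≤-trans 1≤b (ℕₚ.m≤m+n b (sum r)))))))
  ∑-toComposition-point (suc m) t {a} {r} t<a 1≤r a≡ with a ℕ.≟ suc t
  ... | yes ≡.refl = trans (∑-subsets-suc m _) (trans (+-cong (split-head r 1≤r (ℕₚ.+-cancelˡ-≡ (suc t) _ _ a≡))
                       (∑-zero (subsets m) tail-mismatch)) (+-identityʳ 1#))
    where
    split-head : ∀ r → All (1 ≤_) r → sum r ≡ suc m →
                 ∑[ V ∈ subsets m ] when ((suc t ∷ toComposition 0 V) ≡ˡ (suc t ∷ r)) 1# ≈ 1#
    split-head (b ∷ r) (1≤b ∷ 1≤r) b+r≡ = trans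
      (∑-cong (subsets m) λ V → reflexive (≡.cong (λ d → when d 1#) (≡ˡ-∷-head (suc t) (toComposition 0 V) (b ∷ r))))
      (∑-toComposition-point m 0 1≤b 1≤r b+r≡)
    tail-mismatch : ∀ V → when (toComposition (suc t) V ≡ˡ (suc t ∷ r)) 1# ≈ 0#
    tail-mismatch V with head-toComposition (suc t) V
    ... | b , r′ , e , t<b = reflexive (≡.cong (λ d → when d 1#)
          (≡.trans (≡.cong (_≡ˡ (suc t ∷ r)) e) (≡ˡ-∷-≢ r′ r (ℕₚ.>⇒≢ t<b))))
  ... | no a≢ = trans (∑-subsets-suc m _) (trans (+-cong (∑-zero (subsets m) head-mismatch)
                  (∑-toComposition-point m (suc t) (ℕₚ.≤∧≢⇒< t<a (a≢ ∘ ≡.sym)) 1≤r (≡.trans a≡ (ℕₚ.+-suc (suc t) m))))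
                  (+-identityˡ 1#))
    where
    head-mismatch : ∀ V → when ((suc t ∷ toComposition 0 V) ≡ˡ (a ∷ r)) 1# ≈ 0#
    head-mismatch V = reflexive (≡.cong (λ d → when d 1#) (≡ˡ-∷-≢ (toComposition 0 V) r (a≢ ∘ ≡.sym)))

  ∑-toComposition-composition : ∀ m {γ} → IsComposition (suc m) γ → ∑[ V ∈ subsets m ] when (toComposition 0 V ≡ˡ γ) 1# ≈ 1#
  ∑-toComposition-composition m {a ∷ r} (1≤a ∷ 1≤r , a+r≡) = ∑-toComposition-point m 0 1≤a 1≤r a+r≡

  ∑-comps-w₀ : ∀ n cβ → W₀Coords R n cβ → (X : Vec ℕ n → Carrier) →
    ∑[ β ∈ comps n ] (cβ β * ∑[ G ∈ faces n ] when (type G ≡ˡ β) (X G)) ≈ ∑[ G ∈ faces n ] (sgn R (n ∸ len G) * X G)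
  ∑-comps-w₀ zero    cβ w₀ X = +-congʳ (*-cong (trans (sym (+-identityʳ _)) (w₀ Perm.id)) (+-identityʳ _))
  ∑-comps-w₀ (suc m) cβ w₀ X = begin
    ∑[ β ∈ comps n ] (cβ β * ∑[ G ∈ faces n ] when (type G ≡ˡ β) (X G))
      ≡⟨ ≡.cong (λ C → ∑[ β ∈ C ] (cβ β * ∑[ G ∈ faces n ] when (type G ≡ˡ β) (X G))) (comps≡map-toComposition m) ⟩
    ∑[ β ∈ map (toComposition 0) (subsets m) ] (cβ β * ∑[ G ∈ faces n ] when (type G ≡ˡ β) (X G))
      ≡⟨ ∑-map (toComposition 0) (subsets m) _ ⟩
    ∑[ V ∈ subsets m ] (cᵥ V * ∑[ G ∈ faces n ] when (type G ≡ˡ toComposition 0 V) (X G))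
      ≈⟨ ∑-cong (subsets m) (λ V → sym (∑-*ˡ (faces n) _ _)) ⟩
    ∑[ V ∈ subsets m ] ∑[ G ∈ faces n ] (cᵥ V * when (type G ≡ˡ toComposition 0 V) (X G))
      ≈⟨ ∑-comm (subsets m) (faces n) _ ⟩
    ∑[ G ∈ faces n ] ∑[ V ∈ subsets m ] (cᵥ V * when (type G ≡ˡ toComposition 0 V) (X G))
      ≈⟨ ∑-cong (faces n) (λ G → trans (∑-cong (subsets m) (coefficient G)) (∑-*ʳ (subsets m) _ _)) ⟩
    ∑[ G ∈ faces n ] (∑[ V ∈ subsets m ] when (toComposition 0 V ≡ˡ type G) 1# * (sgn R (n ∸ len G) * X G))
      ≈⟨ ∑-cong∈ (faces n) (λ {G} G∈ → trans
           (*-congʳ (∑-toComposition-composition m (type-isComposition {G = G} (∈-faces⁻ G∈)))) (*-identityˡ _)) ⟩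
    ∑[ G ∈ faces n ] (sgn R (n ∸ len G) * X G) ∎
    where
    n = suc m
    cᵥ : Vec Bool m → Carrier
    cᵥ V = cβ (toComposition 0 V)
    coefficient : ∀ G V → cᵥ V * when (type G ≡ˡ toComposition 0 V) (X G)
                        ≈ when (toComposition 0 V ≡ˡ type G) 1# * (sgn R (n ∸ len G) * X G)
    coefficient G V rewrite ≡ˡ-sym (toComposition 0 V) (type G) with type G ≡ˡ toComposition 0 V in e
    ... | false = trans (zeroʳ _) (sym (zeroˡ _))
    ... | true  = trans (*-congʳ (trans (W₀Coords⇒sgn m cβ w₀ V) (reflexive (≡.cong (sgn R) (≡.trans (#false≡∸length V)
                    (≡.cong (n ∸_) (≡.trans (≡.cong length (≡.sym (≡ˡ⇒≡ (≡.subst T (≡.sym e) _)))) (length-type G))))))))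
                    (sym (*-identityˡ _))

  -- Alternating sums over faces

  ∑-faces : ∀ n f → ∑ (faces n) f ≈ ∑[ G ∈ vecs n n ] when (isFace G) (f G)
  ∑-faces n = ∑-filter (λ v → T? (isFace v)) (vecs n n)

  ∑-faces-bound : ∀ k b f → k ≤ b → ∑[ G ∈ vecs k b ] when (isFace G) (f G) ≈ ∑[ G ∈ vecs k k ] when (isFace G) (f G)
  ∑-faces-bound k b f k≤b = ∑-vecs-bijection b k isFace isFace id id f
    (λ {v} _ t → Face⇒bounded v (isFace⇒Face v t) , t , ≡.refl)
    (λ {w} _ t → AllV.map (λ x<k → ℕₚ.<-≤-trans x<k k≤b) (Face⇒bounded w (isFace⇒Face w t)) , t , ≡.refl)

  shared-head : ∀ {k} g (G : Vec ℕ k) (t : ℕ → Carrier) →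
    when (isSharedHeadFace (g Vec.∷ G)) (t (len (g Vec.∷ G))) ≈ when (g <ᵇ len G) (when (isFace G) (t (len G)))
  shared-head g G t = trans (when-ext _ ((g <ᵇ len G) ∧ isFace G) to from) (reflexive (≡.sym (when-∧ (g <ᵇ len G) (isFace G) _)))
    where
    to : T (isSharedHeadFace (g Vec.∷ G)) → T ((g <ᵇ len G) ∧ isFace G) × t (len (g Vec.∷ G)) ≈ t (len G)
    to t′ with Equivalence.to T-∧ t′
    ... | face , g∈G with Onto-∷⁻ G (Face⇒Onto (g Vec.∷ G) (isFace⇒Face (g Vec.∷ G) face)) (elemᵇ⁻ g G g∈G)
    ...   | onto , g< = let len≡ = Onto⇒len≡ G onto in
            Equivalence.from T-∧ (ℕₚ.<⇒<ᵇ (≡.subst (g <_) (≡.sym len≡) g<) , Face⇒isFace G (Onto⇒Face G onto)) ,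
            reflexive (≡.cong t (≡.sym len≡))
    from : T ((g <ᵇ len G) ∧ isFace G) → T (isSharedHeadFace (g Vec.∷ G))
    from t′ with Equivalence.to T-∧ t′
    ... | g< , face with Onto-∷⁺ G (Face⇒Onto G (isFace⇒Face G face)) (ℕₚ.<ᵇ⇒< g (len G) g<)
    ...   | onto , (y , e) = Equivalence.from T-∧ (Face⇒isFace (g Vec.∷ G) (Onto⇒Face (g Vec.∷ G) onto) , elemᵇ⁺ g G y e)

  ∑-shared-head : ∀ k (t : ℕ → Carrier) →
    ∑[ G ∈ vecs (suc k) (suc k) ] when (isSharedHeadFace G) (t (len G))
    ≈ ∑[ G ∈ vecs k k ] when (isFace G) (fromℕ R (len G) * t (len G))
  ∑-shared-head k t = begin
    ∑[ G ∈ vecs (suc k) (suc k) ] when (isSharedHeadFace G) (t (len G))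
      ≈⟨ ∑-vecs-∷ k (suc k) _ ⟩
    ∑[ g ∈ upTo (suc k) ] ∑[ G ∈ vecs k (suc k) ] when (isSharedHeadFace (g Vec.∷ G)) (t (len (g Vec.∷ G)))
      ≈⟨ ∑-cong (upTo (suc k)) (λ g → ∑-cong (vecs k (suc k)) λ G → shared-head g G t) ⟩
    ∑[ g ∈ upTo (suc k) ] ∑[ G ∈ vecs k (suc k) ] when (g <ᵇ len G) (when (isFace G) (t (len G)))
      ≈⟨ ∑-comm (upTo (suc k)) (vecs k (suc k)) _ ⟩
    ∑[ G ∈ vecs k (suc k) ] ∑[ g ∈ upTo (suc k) ] when (g <ᵇ len G) (when (isFace G) (t (len G)))
      ≈⟨ ∑-cong (vecs k (suc k)) count ⟩
    ∑[ G ∈ vecs k (suc k) ] when (isFace G) (fromℕ R (len G) * t (len G))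
      ≈⟨ ∑-faces-bound k (suc k) _ (ℕₚ.n≤1+n k) ⟩
    ∑[ G ∈ vecs k k ] when (isFace G) (fromℕ R (len G) * t (len G)) ∎
    where
    count : ∀ G → ∑[ g ∈ upTo (suc k) ] when (g <ᵇ len G) (when (isFace G) (t (len G))) ≈ when (isFace G) (fromℕ R (len G) * t (len G))
    count G with isFace G in e
    ... | false = ∑-zero (upTo (suc k)) λ g → when-0 (g <ᵇ len G)
    ... | true  = ∑-upTo-<ᵇ (suc k) _ (ℕₚ.m≤n⇒m≤1+n (isFace⇒len≤ G (≡.subst T (≡.sym e) tt)))

  ∑-singleton-head : ∀ k (t : ℕ → Carrier) →
    ∑[ G ∈ vecs (suc k) (suc k) ] when (isSingletonHeadFace G) (t (len G))
    ≈ ∑[ G ∈ vecs k k ] when (isFace G) (fromℕ R (suc (len G)) * t (suc (len G)))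
  ∑-singleton-head k t = begin
    ∑[ G ∈ vecs (suc k) (suc k) ] when (isSingletonHeadFace G) (t (len G))
      ≈⟨ ∑-cong (vecs (suc k) (suc k)) (λ G → when-ext (isSingletonHeadFace G) (isSingletonHeadFace G)
           (λ s → s , reflexive (≡.cong t (len-singleton-head G s))) id) ⟩
    ∑[ G ∈ vecs (suc k) (suc k) ] when (isSingletonHeadFace G) (t′ (closeHead G))
      ≈⟨ ∑-vecs-bijection (suc k) (suc k) isSingletonHeadFace isHeadPlacement closeHead openHead t′ closeHead-inverse openHead-inverse ⟩
    ∑[ w ∈ vecs (suc k) (suc k) ] when (isHeadPlacement w) (t′ w)
      ≈⟨ ∑-vecs-∷ k (suc k) _ ⟩
    ∑[ g ∈ upTo (suc k) ] ∑[ G ∈ vecs k (suc k) ] when (isFace G ∧ (g <ᵇ suc (len G))) (t (suc (len G)))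
      ≈⟨ ∑-comm (upTo (suc k)) (vecs k (suc k)) _ ⟩
    ∑[ G ∈ vecs k (suc k) ] ∑[ g ∈ upTo (suc k) ] when (isFace G ∧ (g <ᵇ suc (len G))) (t (suc (len G)))
      ≈⟨ ∑-cong (vecs k (suc k)) count ⟩
    ∑[ G ∈ vecs k (suc k) ] when (isFace G) (fromℕ R (suc (len G)) * t (suc (len G)))
      ≈⟨ ∑-faces-bound k (suc k) _ (ℕₚ.n≤1+n k) ⟩
    ∑[ G ∈ vecs k k ] when (isFace G) (fromℕ R (suc (len G)) * t (suc (len G))) ∎
    where
    t′ : Vec ℕ (suc k) → Carrier
    t′ w = t (suc (len (Vec.tail w)))
    count : ∀ G → ∑[ g ∈ upTo (suc k) ] when (isFace G ∧ (g <ᵇ suc (len G))) (t (suc (len G)))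
                ≈ when (isFace G) (fromℕ R (suc (len G)) * t (suc (len G)))
    count G with isFace G in e
    ... | false = ∑-zero (upTo (suc k)) λ _ → refl
    ... | true  = ∑-upTo-<ᵇ (suc k) _ (s≤s (isFace⇒len≤ G (≡.subst T (≡.sym e) tt)))

  ∑-faces-sgn : ∀ k → ∑[ G ∈ vecs k k ] when (isFace G) (sgn R (k ∸ len G)) ≈ 1#
  ∑-faces-sgn zero    = +-identityʳ _
  ∑-faces-sgn (suc k) = begin
    ∑[ G ∈ Vs ] when (isFace G) (t (len G))
      ≈⟨ ∑-cong Vs (λ G → when-split (isFace G) (elemᵇ (Vec.head G) (toList (Vec.tail G))) _) ⟩
    ∑[ G ∈ Vs ] (when (isSharedHeadFace G) (t (len G)) + when (isSingletonHeadFace G) (t (len G)))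
      ≈⟨ ∑-+ Vs _ _ ⟩
    ∑[ G ∈ Vs ] when (isSharedHeadFace G) (t (len G)) + ∑[ G ∈ Vs ] when (isSingletonHeadFace G) (t (len G))
      ≈⟨ +-cong (∑-shared-head k t) (∑-singleton-head k t) ⟩
    ∑[ G ∈ vecs k k ] when (isFace G) (fromℕ R (len G) * t (len G)) +
    ∑[ G ∈ vecs k k ] when (isFace G) (fromℕ R (suc (len G)) * t (suc (len G)))
      ≈⟨ sym (∑-+ (vecs k k) _ _) ⟩
    ∑[ G ∈ vecs k k ] (when (isFace G) (fromℕ R (len G) * t (len G)) +
                       when (isFace G) (fromℕ R (suc (len G)) * t (suc (len G))))
      ≈⟨ ∑-cong (vecs k k) telescope ⟩
    ∑[ G ∈ vecs k k ] when (isFace G) (sgn R (k ∸ len G))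
      ≈⟨ ∑-faces-sgn k ⟩
    1# ∎
    where
    Vs = vecs (suc k) (suc k)
    t : ℕ → Carrier
    t L = sgn R (suc k ∸ L)
    x*-s+[1+x]*s≈s : ∀ x s → x * (- s) + (1# + x) * s ≈ s
    x*-s+[1+x]*s≈s x s = begin
      x * (- s) + (1# + x) * s        ≈⟨ +-cong (sym (-‿distribʳ-* x s)) (distribʳ s 1# x) ⟩
      - (x * s) + (1# * s + x * s)    ≈⟨ +-congˡ (+-comm _ _) ⟩
      - (x * s) + (x * s + 1# * s)    ≈⟨ sym (+-assoc _ _ _) ⟩
      (- (x * s) + x * s) + 1# * s    ≈⟨ +-cong (-‿inverseˡ _) (*-identityˡ s) ⟩
      0# + s                          ≈⟨ +-identityˡ s ⟩
      s                               ∎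
    telescope : ∀ G → when (isFace G) (fromℕ R (len G) * t (len G)) +
                      when (isFace G) (fromℕ R (suc (len G)) * t (suc (len G))) ≈ when (isFace G) (sgn R (k ∸ len G))
    telescope G with isFace G in e
    ... | false = +-identityˡ 0#
    ... | true  = trans (+-congʳ (*-congˡ (reflexive (≡.cong (sgn R) (ℕₚ.+-∸-assoc 1 (isFace⇒len≤ G (≡.subst T (≡.sym e) tt)))))))
                        (x*-s+[1+x]*s≈s _ _)

  ∑-coarsenings-sgn : ∀ {n} (F : Vec ℕ n) → Face F →
    ∑[ G ∈ vecs n n ] when (isFace G ∧ (F ⪯ᵇ G)) (sgn R (n ∸ len G)) ≈ sgn R (n ∸ len F)
  ∑-coarsenings-sgn {n} F face = begin
    ∑[ G ∈ vecs n n ] when (isFace G ∧ (F ⪯ᵇ G)) (sgn R (n ∸ len G))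
      ≈⟨ ∑-cong (vecs n n) (λ G → when-ext (isFace G ∧ (F ⪯ᵇ G)) (isFace G ∧ (F ⪯ᵇ G))
           (λ t → t , reflexive (≡.cong (λ L → sgn R (n ∸ L)) (≡.sym (len-collapse {G} t)))) id) ⟩
    ∑[ G ∈ vecs n n ] when (isFace G ∧ (F ⪯ᵇ G)) (sgn R (n ∸ len (collapse G)))
      ≈⟨ ∑-vecs-bijection n k (λ G → isFace G ∧ (F ⪯ᵇ G)) isFace collapse expand (λ H → sgn R (n ∸ len H))
           (λ _ → collapse-inverse) (λ _ → expand-inverse) ⟩
    ∑[ H ∈ vecs k k ] when (isFace H) (sgn R (n ∸ len H))
      ≈⟨ ∑-cong (vecs k k) split-sgn ⟩
    ∑[ H ∈ vecs k k ] (sgn R (n ∸ k) * when (isFace H) (sgn R (k ∸ len H)))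
      ≈⟨ ∑-*ˡ (vecs k k) _ _ ⟩
    sgn R (n ∸ k) * ∑[ H ∈ vecs k k ] when (isFace H) (sgn R (k ∸ len H))
      ≈⟨ *-congˡ (∑-faces-sgn k) ⟩
    sgn R (n ∸ k) * 1#
      ≈⟨ *-identityʳ _ ⟩
    sgn R (n ∸ len F) ∎
    where
    open Coarsening F face
    k = len F
    split-sgn : ∀ H → when (isFace H) (sgn R (n ∸ len H)) ≈ sgn R (n ∸ k) * when (isFace H) (sgn R (k ∸ len H))
    split-sgn H with isFace H in e
    ... | false = sym (zeroʳ _)
    ... | true  = trans (reflexive (≡.cong (sgn R) (≡.trans (≡.cong (_∸ len H) (≡.sym (ℕₚ.m∸n+n≡m (Face⇒len≤ F face))))
                    (ℕₚ.+-∸-assoc (n ∸ k) (isFace⇒len≤ H (≡.subst T (≡.sym e) tt))))))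
                    (sgn-+ (n ∸ k) (k ∸ len H))

  -- The coefficients of F w̃₀ B̃_α

  module _ {n : ℕ} where

    ∑-⊛ : ∀ (x y : Alg R n) (g : Carrier × Vec ℕ n → Carrier) →
          ∑ (_⊛_ R x y) g ≈ ∑[ p ∈ x ] ∑[ q ∈ y ] g (proj₁ p * proj₁ q , proj₂ p ·ᶠ proj₂ q)
    ∑-⊛ x y g = trans (∑-concatMap _ x g) (∑-cong x λ p → reflexive (∑-map _ y g))

    ∑-⊙ : ∀ a (x : Alg R n) (g : Carrier × Vec ℕ n → Carrier) → ∑ (_⊙_ R a x) g ≡ ∑[ q ∈ x ] g (a * proj₁ q , proj₂ q)
    ∑-⊙ a x g = ∑-map _ x g

    ∑-sumOver : ∀ (P : Vec ℕ n → Bool) d (g : Carrier × Vec ℕ n → Carrier) →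
                ∑ (sumOver R P d) g ≈ ∑[ G ∈ faces n ] when (P G) (g (d G , G))
    ∑-sumOver P d g = trans (reflexive (∑-map _ (filter (λ G → T? (P G)) (faces n)) g)) (∑-filter (λ G → T? (P G)) (faces n) _)

    ∑-faces-point : ∀ (f : Vec ℕ n → Carrier) H → ∑[ G ∈ faces n ] when (G ≡ᵛ H) (f G) ≈ when (isFace H) (f H)
    ∑-faces-point f H = trans (∑-faces n _) (lemma (isFace H) ≡.refl)
      where
      lemma : ∀ b → isFace H ≡ b → ∑[ G ∈ vecs n n ] when (isFace G) (when (G ≡ᵛ H) (f G)) ≈ when b (f H)
      lemma true  e = trans (∑-cong (vecs n n) λ G → reflexive (when-comm (isFace G) (G ≡ᵛ H)))
                        (trans (∑-vecs-point n n (λ G → when (isFace G) (f G)) (Face⇒bounded H (isFace⇒Face H (≡.subst T (≡.sym e) tt))))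
                        (reflexive (≡.cong (λ b → when b (f H)) e)))
      lemma false e = ∑-zero (vecs n n) term
        where
        term : ∀ G → when (isFace G) (when (G ≡ᵛ H) (f G)) ≈ 0#
        term G with G ≡ᵛ H in G≡H
        ... | false = when-0 (isFace G)
        ... | true rewrite ≡ᵛ⇒≡ {u = G} (≡.subst T (≡.sym G≡H) tt) | e = refl

    coeff-sumOver : ∀ (P : Vec ℕ n → Bool) d H → coeff R (sumOver R P d) H ≈ when (isFace H) (when (P H) (d H))
    coeff-sumOver P d H = begin
      coeff R (sumOver R P d) H                          ≈⟨ ∑-sumOver P d _ ⟩
      ∑[ G ∈ faces n ] when (P G) (when (G ≡ᵛ H) (d G))  ≈⟨ ∑-cong (faces n) (λ G → reflexive (when-comm (P G) (G ≡ᵛ H))) ⟩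
      ∑[ G ∈ faces n ] when (G ≡ᵛ H) (when (P G) (d G))  ≈⟨ ∑-faces-point (λ G → when (P G) (d G)) H ⟩
      when (isFace H) (when (P H) (d H))                 ∎

  module _ (n : ℕ) (F : Vec ℕ n) (α : List ℕ) where

    Fw̃₀B̃α : (List ℕ → Carrier) → Alg R n
    Fw̃₀B̃α cβ = _⊛_ R (_⊛_ R (basis R F) (ρ R n cβ)) (B̃ R n α)

    occurrences : Vec ℕ n → Vec ℕ n → Carrier
    occurrences H G = ∑[ K ∈ faces n ] when (type K ≡ˡ α) (when ((F ·ᶠ G) ·ᶠ K ≡ᵛ H) 1#)

    coeff-Fw̃₀B̃α-comps : ∀ cβ H → coeff R (Fw̃₀B̃α cβ) H
                         ≈ ∑[ β ∈ comps n ] (cβ β * ∑[ G ∈ faces n ] when (type G ≡ˡ β) (occurrences H G))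
    coeff-Fw̃₀B̃α-comps cβ H = begin
      coeff R (Fw̃₀B̃α cβ) H
        ≈⟨ trans (∑-⊛ (_⊛_ R (basis R F) (ρ R n cβ)) (B̃ R n α) _) (trans (∑-⊛ (basis R F) (ρ R n cβ) _) (+-identityʳ _)) ⟩
      ∑[ q ∈ ρ R n cβ ] ∑[ r ∈ B̃ R n α ] at ((1# * proj₁ q) * proj₁ r) ((F ·ᶠ proj₂ q) ·ᶠ proj₂ r)
        ≈⟨ ∑-concatMap _ (comps n) _ ⟩
      ∑[ β ∈ comps n ] ∑[ q ∈ _⊙_ R (cβ β) (B̃ R n β) ] ∑[ r ∈ B̃ R n α ]
        at ((1# * proj₁ q) * proj₁ r) ((F ·ᶠ proj₂ q) ·ᶠ proj₂ r)
        ≈⟨ ∑-cong (comps n) (λ β → trans (reflexive (∑-⊙ (cβ β) (B̃ R n β) _)) (∑-sumOver (λ G → type G ≡ˡ β) (λ _ → 1#)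
             (λ q → ∑[ r ∈ B̃ R n α ] at ((1# * (cβ β * proj₁ q)) * proj₁ r) ((F ·ᶠ proj₂ q) ·ᶠ proj₂ r)))) ⟩
      ∑[ β ∈ comps n ] ∑[ G ∈ faces n ] when (type G ≡ˡ β)
        (∑[ r ∈ B̃ R n α ] at ((1# * (cβ β * 1#)) * proj₁ r) ((F ·ᶠ G) ·ᶠ proj₂ r))
        ≈⟨ ∑-cong (comps n) (λ β → trans (∑-cong (faces n) (term β)) (∑-*ˡ (faces n) _ _)) ⟩
      ∑[ β ∈ comps n ] (cβ β * ∑[ G ∈ faces n ] when (type G ≡ˡ β) (occurrences H G)) ∎
      where
      at : Carrier → Vec ℕ n → Carrier
      at a G = when (G ≡ᵛ H) a
      ∑-B̃α : ∀ G a → ∑[ r ∈ B̃ R n α ] at (a * proj₁ r) ((F ·ᶠ G) ·ᶠ proj₂ r) ≈ a * occurrences H G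
      ∑-B̃α G a = begin
        ∑[ r ∈ B̃ R n α ] at (a * proj₁ r) ((F ·ᶠ G) ·ᶠ proj₂ r)
          ≈⟨ ∑-sumOver (λ K → type K ≡ˡ α) (λ _ → 1#) (λ q → at (a * proj₁ q) ((F ·ᶠ G) ·ᶠ proj₂ q)) ⟩
        ∑[ K ∈ faces n ] when (type K ≡ˡ α) (when ((F ·ᶠ G) ·ᶠ K ≡ᵛ H) (a * 1#))
          ≈⟨ ∑-cong (faces n) (λ K → trans (when-cong (type K ≡ˡ α) (sym (when-*ʳ ((F ·ᶠ G) ·ᶠ K ≡ᵛ H) a 1#)))
                                           (sym (when-*ʳ (type K ≡ˡ α) a _))) ⟩
        ∑[ K ∈ faces n ] (a * when (type K ≡ˡ α) (when ((F ·ᶠ G) ·ᶠ K ≡ᵛ H) 1#))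
          ≈⟨ ∑-*ˡ (faces n) a _ ⟩
        a * occurrences H G ∎
      term : ∀ β G → when (type G ≡ˡ β) (∑[ r ∈ B̃ R n α ] at ((1# * (cβ β * 1#)) * proj₁ r) ((F ·ᶠ G) ·ᶠ proj₂ r))
                   ≈ cβ β * when (type G ≡ˡ β) (occurrences H G)
      term β G = trans (when-cong (type G ≡ˡ β) (trans (∑-B̃α G _) (*-congʳ (trans (*-identityˡ _) (*-identityʳ _)))))
                       (sym (when-*ʳ (type G ≡ˡ β) (cβ β) _))

    coeff-Fw̃₀B̃α : ∀ cβ → W₀Coords R n cβ → ∀ H →
                coeff R (Fw̃₀B̃α cβ) H ≈ ∑[ G ∈ faces n ] (sgn R (n ∸ len G) * occurrences H G)
    coeff-Fw̃₀B̃α cβ w₀ H = trans (coeff-Fw̃₀B̃α-comps cβ H) (∑-comps-w₀ n cβ w₀ (occurrences H))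

  module _ (n : ℕ) (F : Vec ℕ n) (face : Face F) (α : List ℕ) where

    ·ᶠ·ᶠ≡ᵛ : ∀ {G K} → Face G → Face K → ((F ·ᶠ G) ·ᶠ K ≡ᵛ F) ≡ ((F ⪯ᵇ G) ∧ (F ⪯ᵇ K))
    ·ᶠ·ᶠ≡ᵛ {G} {K} fG fK = T-injective
      (λ t → let (F⪯G , F⪯K) = ·ᶠ·ᶠ≡⇒⪯ F G K face fG fK (≡ᵛ⇒≡ t) in
             Equivalence.from T-∧ (⪯⇒⪯ᵇ F G F⪯G , ⪯⇒⪯ᵇ F K F⪯K))
      (λ t → let (F⪯G , F⪯K) = Equivalence.to T-∧ t in
             ≡⇒≡ᵛ (⪯⇒·ᶠ·ᶠ≡ F G K face fG fK (⪯ᵇ⇒⪯ F G F⪯G) (⪯ᵇ⇒⪯ F K F⪯K)))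

    ∑-type-⪯ : ∑[ K ∈ faces n ] when (type K ≡ˡ α) (when (F ⪯ᵇ K) 1#) ≈ fromℕ R (nα R α F)
    ∑-type-⪯ = sym (begin
      fromℕ R (nα R α F)                                           ≈⟨ fromℕ-length (filter P? (faces n)) ⟩
      ∑[ _ ∈ filter P? (faces n) ] 1#                              ≈⟨ ∑-filter P? (faces n) _ ⟩
      ∑[ K ∈ faces n ] when ((F ⪯ᵇ K) ∧ (type K ≡ˡ α)) 1#          ≈⟨ ∑-cong (faces n) (λ K → reflexive
                                                                        (≡.trans (≡.sym (when-∧ (F ⪯ᵇ K) _ 1#)) (when-comm (F ⪯ᵇ K) (type K ≡ˡ α)))) ⟩
      ∑[ K ∈ faces n ] when (type K ≡ˡ α) (when (F ⪯ᵇ K) 1#)      ∎)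
      where P? = λ G → T? ((F ⪯ᵇ G) ∧ (type G ≡ˡ α))

    occurrences-F : ∀ {G} → Face G → occurrences n F α F G ≈ when (F ⪯ᵇ G) (fromℕ R (nα R α F))
    occurrences-F {G} fG = begin
      ∑[ K ∈ faces n ] when (type K ≡ˡ α) (when ((F ·ᶠ G) ·ᶠ K ≡ᵛ F) 1#)
        ≈⟨ ∑-cong∈ (faces n) (λ {K} K∈ → trans
             (reflexive (≡.cong (λ b → when (type K ≡ˡ α) (when b 1#)) (·ᶠ·ᶠ≡ᵛ fG (∈-faces⁻ K∈))))
             (factor (type K ≡ˡ α) (F ⪯ᵇ G) (F ⪯ᵇ K))) ⟩
      ∑[ K ∈ faces n ] when (F ⪯ᵇ G) (when (type K ≡ˡ α) (when (F ⪯ᵇ K) 1#))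
        ≈⟨ ∑-when (faces n) (F ⪯ᵇ G) _ ⟩
      when (F ⪯ᵇ G) (∑[ K ∈ faces n ] when (type K ≡ˡ α) (when (F ⪯ᵇ K) 1#))
        ≈⟨ when-cong (F ⪯ᵇ G) ∑-type-⪯ ⟩
      when (F ⪯ᵇ G) (fromℕ R (nα R α F)) ∎
      where
      factor : ∀ a b c → when a (when (b ∧ c) 1#) ≈ when b (when a (when c 1#))
      factor a true  c = refl
      factor a false c = when-0 a

    coeff-Fw̃₀B̃α-F : ∀ cβ → W₀Coords R n cβ → coeff R (Fw̃₀B̃α n F α cβ) F ≈ ñα R α F
    coeff-Fw̃₀B̃α-F cβ w₀ = begin
      coeff R (Fw̃₀B̃α n F α cβ) F
        ≈⟨ coeff-Fw̃₀B̃α n F α cβ w₀ F ⟩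
      ∑[ G ∈ faces n ] (sgn R (n ∸ len G) * occurrences n F α F G)
        ≈⟨ ∑-cong∈ (faces n) (λ {G} G∈ → trans (*-congˡ (occurrences-F (∈-faces⁻ G∈))) (sym (when-extract (F ⪯ᵇ G)))) ⟩
      ∑[ G ∈ faces n ] (when (F ⪯ᵇ G) (sgn R (n ∸ len G)) * N)
        ≈⟨ ∑-*ʳ (faces n) N _ ⟩
      ∑[ G ∈ faces n ] when (F ⪯ᵇ G) (sgn R (n ∸ len G)) * N
        ≈⟨ *-congʳ (trans (∑-faces n _) (∑-cong (vecs n n) λ G → reflexive (when-∧ (isFace G) (F ⪯ᵇ G) _))) ⟩
      ∑[ G ∈ vecs n n ] when (isFace G ∧ (F ⪯ᵇ G)) (sgn R (n ∸ len G)) * N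
        ≈⟨ *-congʳ (∑-coarsenings-sgn F face) ⟩
      sgn R (n ∸ len F) * N ∎
      where
      N = fromℕ R (nα R α F)
      when-extract : ∀ b {s} → when b s * N ≈ s * when b N
      when-extract true  = refl
      when-extract false = trans (zeroˡ N) (sym (zeroʳ _))

    coeff-Fw̃₀B̃α-vanish : ∀ cβ → W₀Coords R n cβ → ∀ H → F ≢ H → ¬ T (isFace H ∧ (len F <ᵇ len H)) →
                       coeff R (Fw̃₀B̃α n F α cβ) H ≈ 0#
    coeff-Fw̃₀B̃α-vanish cβ w₀ H F≢H ¬longer = trans (coeff-Fw̃₀B̃α n F α cβ w₀ H)
      (∑-zero∈ (faces n) λ {G} G∈ → trans
        (*-congˡ (∑-zero∈ (faces n) λ {K} K∈ → term {G} {K} (∈-faces⁻ G∈) (∈-faces⁻ K∈))) (zeroʳ _))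
      where
      term : ∀ {G K} → Face G → Face K → when (type K ≡ˡ α) (when ((F ·ᶠ G) ·ᶠ K ≡ᵛ H) 1#) ≈ 0#
      term {G} {K} fG fK with (F ·ᶠ G) ·ᶠ K ≡ᵛ H in e
      ... | false = when-0 (type K ≡ˡ α)
      ... | true  = ⊥-elim (¬longer (≡.subst (λ H → T (isFace H ∧ (len F <ᵇ len H))) (≡ᵛ⇒≡ (≡.subst T (≡.sym e) tt)) longer))
        where
        FGK≢F : (F ·ᶠ G) ·ᶠ K ≢ F
        FGK≢F FGK≡F = F≢H (≡.trans (≡.sym FGK≡F) (≡ᵛ⇒≡ (≡.subst T (≡.sym e) tt)))
        longer : T (isFace ((F ·ᶠ G) ·ᶠ K) ∧ (len F <ᵇ len ((F ·ᶠ G) ·ᶠ K)))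
        longer = Equivalence.from T-∧ (Face⇒isFace ((F ·ᶠ G) ·ᶠ K) (·ᶠ·ᶠ-face F G K face fG fK) ,
                                       ℕₚ.<⇒<ᵇ (·ᶠ·ᶠ≢⇒len< F G K face fG fK FGK≢F))

    coeff-Fw̃₀B̃α-support : ∀ cβ → W₀Coords R n cβ → ∀ H →
      coeff R (Fw̃₀B̃α n F α cβ) H
        ≈ when (F ≡ᵛ H) (ñα R α F) + when (isFace H ∧ (len F <ᵇ len H)) (coeff R (Fw̃₀B̃α n F α cβ) H)
    coeff-Fw̃₀B̃α-support cβ w₀ H with Vecₚ.≡-dec ℕ._≟_ F H
    ... | yes ≡.refl rewrite ¬T⇒≡false (ℕₚ.<-irrefl ≡.refl ∘ ℕₚ.<ᵇ⇒< (len F) (len F)) | Boolₚ.∧-zeroʳ (isFace F) =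
      trans (coeff-Fw̃₀B̃α-F cβ w₀) (sym (+-identityʳ _))
    ... | no F≢H with isFace H ∧ (len F <ᵇ len H) in longer
    ...   | true  = sym (+-identityˡ _)
    ...   | false = trans (coeff-Fw̃₀B̃α-vanish cβ w₀ H F≢H (λ t → ≡.subst T longer t)) (sym (+-identityˡ 0#))

  coeff-⊙basis⊕sumOver : ∀ {n} a (F : Vec ℕ n) P d H →
    coeff R (_⊕_ R (_⊙_ R a (basis R F)) (sumOver R P d)) H ≈ when (F ≡ᵛ H) a + when (isFace H ∧ P H) (d H)
  coeff-⊙basis⊕sumOver a F P d H = trans (∑-++ (_⊙_ R a (basis R F)) (sumOver R P d) _)
    (+-cong (trans (+-identityʳ _) (when-cong (F ≡ᵛ H) (*-identityʳ a)))
            (trans (coeff-sumOver P d H) (reflexive (when-∧ (isFace H) (P H) (d H)))))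

lemma8p3 : ∀ {c ℓ} (R : CommutativeRing c ℓ) (n : ℕ) (F : Vec ℕ n) → T (isFace F)
         → (α : List ℕ) → IsComposition n α
         → (cβ : List ℕ → CommutativeRing.Carrier R) → W₀Coords R n cβ
         → ∃ λ (d : Vec ℕ n → CommutativeRing.Carrier R) →
             _≋_ R (_⊛_ R (_⊛_ R (basis R F) (ρ R n cβ)) (B̃ R n α))
                   (_⊕_ R (_⊙_ R (ñα R α F) (basis R F))
                          (sumOver R (λ G → len F <ᵇ len G) d))
lemma8p3 R n F F-face α _ cβ w₀ = coeff R (Fw̃₀B̃α R n F α cβ) , λ H →
  trans (coeff-Fw̃₀B̃α-support R n F (isFace⇒Face F F-face) α cβ w₀ H)
        (sym (coeff-⊙basis⊕sumOver R (ñα R α F) F (λ G → len F <ᵇ len G) (coeff R (Fw̃₀B̃α R n F α cβ)) H))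
  where open CommutativeRing R using (sym; trans)
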